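{- Let $p_1\geq0$, $p_2\geq0$, $\ell_1\geq\ell_2\geq1$ be integers with $p_1+p_2\geq2$, and let $T$ be the spider graph $Sp_{p_1,p_2;\ell_1,\ell_2}$ with its leaves as boundary. Then the Steklov eigenvalues of $T$, listed with multiplicity, are: $0$ (once); $\frac{1}{\ell_1}$ with multiplicity $\max(p_1-1,0)$; $\frac{p_1+p_2}{\ell_2p_1+\ell_1p_2}$ with multiplicity $1$ if $p_1\geq1$ and $p_2\geq1$ (and multiplicity $0$ otherwise); and $\frac{1}{\ell_2}$ with multiplicity $\max(p_2-1,0)$. In particular, when $p_1,p_2\geq1$: $\sigma_1=0$, $\sigma_2=\cdots=\sigma_{p_1}=\frac1{\ell_1}$, $\sigma_{p_1+1}=\frac{p_1+p_2}{\ell_2p_1+\ell_1p_2}$, $\sigma_{p_1+2}=\cdots=\sigma_{p_1+p_2}=\frac1{\ell_2}$.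
   Context: For a finite tree $T=(V,E)$, the boundary $B$ is the set of leaves. For $f\in\mathbb{R}^B$ let $\hat f$ be the harmonic extension: $\hat f=f$ on $B$ and $\sum_{y\sim x}(\hat f(x)-\hat f(y))=0$ for $x\in V\setminus B$. The Steklov operator is $\Lambda f(x)=\sum_{y\sim x}(\hat f(x)-\hat f(y))$, $x\in B$; its eigenvalues are $0=\sigma_1\leq\sigma_2\leq\cdots\leq\sigma_{|B|}$. The spider graph $Sp_{p_1,p_2;\ell_1,\ell_2}$ is obtained by taking $p_1$ paths of length $\ell_1$ and $p_2$ paths of length $\ell_2$ (length = number of edges) and identifying one endpoint of each into a single vertex. -}

module Defs where

open import Data.Nat as ℕ using (ℕ; zero; suc; pred; _∸_)
open import Data.Fin as Fin using (Fin; zero; suc; fromℕ; splitAt; punchIn; inject₁)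
open import Data.List using (List; []; _∷_; map; foldr; replicate; _++_; [_])
open import Data.Maybe using (Maybe; just; nothing)
import Data.Maybe as Maybe
open import Data.Sum using ([_,_]′)
open import Data.Bool using (if_then_else_)
open import Data.Integer using (+_)
open import Data.Rational using (ℚ; 0ℚ; 1ℚ; _+_; _*_; _-_; -_; _/_)
open import Data.Product using (Σ; _×_; ∃)
open import Relation.Nullary using (¬_; does)
open import Relation.Binary.PropositionalEquality using (_≡_)
open import Data.List.Base using (allFin)

sumℚ : List ℚ → ℚ
sumℚ = foldr _+_ 0ℚ

prodℚ : List ℚ → ℚ
prodℚ = foldr _*_ 1ℚ

ΣFin : (n : ℕ) → (Fin n → ℚ) → ℚ
ΣFin n f = sumℚ (map f (allFin n))

Matrix : ℕ → Set
Matrix n = Fin n → Fin n → ℚ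

apply : ∀ {n} → Matrix n → (Fin n → ℚ) → Fin n → ℚ
apply {n} M f k = ΣFin n (λ j → M k j * f j)

det : ∀ {n} → Matrix n → ℚ
det {zero}  M = 1ℚ
det {suc n} M = go (allFin (suc n)) 1ℚ
  where
  minor : Fin (suc n) → Matrix n
  minor j r c = M (suc r) (punchIn j c)
  go : List (Fin (suc n)) → ℚ → ℚ
  go []       s = 0ℚ
  go (j ∷ js) s = s * M zero j * det (minor j) + go js (- s)

charPoly : ∀ {n} → Matrix n → ℚ → ℚ
charPoly M x = det (λ r c → (if does (r Fin.≟ c) then x else 0ℚ) - M r c)

record Graph : Set₁ where
  field
    V    : Set
    nbrs : V → List V

open Graph public

laplacian : (G : Graph) → (V G → ℚ) → V G → ℚ
laplacian G g x = sumℚ (map (λ y → g x - g y) (nbrs G x))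

-- The boundary is given by an enumeration bd : Fin b → V.
-- M is (the matrix of) the Steklov operator: for every boundary data f and
-- every harmonic extension ĝ of f, (M f)(k) = (L ĝ)(bd k).
IsSteklovMatrix : (G : Graph) {b : ℕ} → (Fin b → V G) → Matrix b → Set
IsSteklovMatrix G {b} bd M =
  (f : Fin b → ℚ) (g : V G → ℚ) →
  (∀ k → g (bd k) ≡ f k) →
  (∀ v → (∀ k → ¬ (bd k ≡ v)) → laplacian G g v ≡ 0ℚ) →
  ∀ k → apply M f k ≡ laplacian G g (bd k)

-- Spider graph Sp_{p₁,p₂;ℓ₁,ℓ₂}: legs i : Fin (p₁ + p₂); legs with
-- i < p₁ have length ℓ₁, the others length ℓ₂.  Vertex  leg i j
-- (j : Fin (suc (pred ℓ))) lies at distance j+1 from the centre; for ℓ ≥ 1,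
-- suc (pred ℓ) = ℓ, so the leg has exactly ℓ edges.

module Spider (p₁ p₂ ℓ₁ ℓ₂ : ℕ) where

  len : Fin (p₁ ℕ.+ p₂) → ℕ
  len i = [ (λ _ → ℓ₁) , (λ _ → ℓ₂) ]′ (splitAt p₁ i)

  data SpV : Set where
    center : SpV
    leg    : (i : Fin (p₁ ℕ.+ p₂)) → Fin (suc (pred (len i))) → SpV

  nextPos : ∀ {m} → Fin (suc m) → Maybe (Fin (suc m))
  nextPos {zero}  zero    = nothing
  nextPos {suc m} zero    = just (suc zero)
  nextPos {suc m} (suc j) = Maybe.map suc (nextPos j)

  prevV : (i : Fin (p₁ ℕ.+ p₂)) → Fin (suc (pred (len i))) → SpV
  prevV i zero    = center
  prevV i (suc j) = leg i (inject₁ j)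

  nextV : (i : Fin (p₁ ℕ.+ p₂)) → Fin (suc (pred (len i))) → List SpV
  nextV i j with nextPos j
  ... | nothing = []
  ... | just j' = [ leg i j' ]

  spNbrs : SpV → List SpV
  spNbrs center    = map (λ i → leg i zero) (allFin (p₁ ℕ.+ p₂))
  spNbrs (leg i j) = prevV i j ∷ nextV i j

  graph : Graph
  graph = record { V = SpV ; nbrs = spNbrs }

  leaf : Fin (p₁ ℕ.+ p₂) → SpV
  leaf i = leg i (fromℕ (pred (len i)))

midEig : (p₁ p₂ ℓ₁ ℓ₂ : ℕ) → List ℚ
midEig (suc a) (suc b) ℓ₁ ℓ₂ =
  [ (+ (suc a ℕ.+ suc b)) / (suc (pred ℓ₂) ℕ.* suc a ℕ.+ suc (pred ℓ₁) ℕ.* suc b) ]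
midEig _ _ _ _ = []

spiderSpectrum : (p₁ p₂ ℓ₁ ℓ₂ : ℕ) → List ℚ
spiderSpectrum p₁ p₂ ℓ₁ ℓ₂ =
  0ℚ ∷ (replicate (p₁ ∸ 1) ((+ 1) / suc (pred ℓ₁))
       ++ midEig p₁ p₂ ℓ₁ ℓ₂
       ++ replicate (p₂ ∸ 1) ((+ 1) / suc (pred ℓ₂)))

{-# OPTIONS --safe #-}
module Submission where

-- A function on the spider that is harmonic away from the leaves is affine along every leg: on leg i
-- it rises from its value c at the centre with a constant slope dᵢ, and its Laplacian at the leaf of
-- leg i is dᵢ.  With wᵢ = 1/ℓᵢ the boundary values force dᵢ = wᵢ (fᵢ - c), and harmonicity at the
-- centre forces Σ dᵢ = 0, i.e. c = Σ wᵢ fᵢ / Σ wᵢ.  So the Steklov matrix is Λ = diag(w) - w wᵀ / Σ w,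
-- and x I - Λ = diag(x - w) + w wᵀ / Σ w has determinant det D + vᵀ adj(D) u by the matrix
-- determinant lemma for D + u vᵀ.  As w takes only the values 1/ℓ₁ (p₁ times) and 1/ℓ₂ (p₂ times),
-- this polynomial factors as x (x - 1/ℓ₁)^(p₁-1) (x - μ) (x - 1/ℓ₂)^(p₂-1) with
-- μ = (p₁ + p₂)/(ℓ₂ p₁ + ℓ₁ p₂) when p₁ and p₂ are both positive, and without the factor x - μ
-- otherwise.  The determinant lemma itself rests on three properties of the first-row expansion that
-- defines det: linearity in each column, a sign change under an adjacent column swap, and invariance
-- under adding multiples of column 0 to the other columns.

module Determinant where

  open import Data.Nat using (ℕ; zero; suc; NonZero)
  import Data.Nat as ℕ
  import Data.Nat.Properties as ℕ
  open import Data.Fin using (Fin; zero; suc; punchIn; punchOut; inject₁; toℕ; _↑ˡ_; _↑ʳ_)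
  open import Data.Fin.Properties using (_≟_; toℕ-inject₁; punchInᵢ≢i; punchIn-injective; punchIn-punchOut)
  open import Data.Fin.Induction using (<-weakInduction)
  open import Data.List using (List; []; _∷_; tabulate; allFin)
  open import Data.List.Membership.Propositional using (_∉_)
  open import Data.List.Membership.Propositional.Properties using (∈-allFin)
  open import Data.List.Relation.Unary.Any using (here; there)
  open import Data.Vec.Functional using (tail; updateAt)
  open import Data.Vec.Functional.Properties using (updateAt-updates; updateAt-minimal)
  open import Data.Bool using (if_then_else_; true; false)
  open import Data.Product using (Σ; _×_; _,_)
  import Data.Integer as ℤ
  import Data.Integer.Properties as ℤ
  import Data.Integer.Tactic.RingSolver as ℤ-Solver
  open import Data.Rational using (ℚ; 0ℚ; 1ℚ; ½; _+_; _*_; _-_; -_; _/_; toℚᵘ; +-*-rawSemiring)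
  import Data.Rational.Properties as ℚ
  open import Data.Rational.Unnormalised using (mkℚᵘ; *≡*; _≃_)
  import Data.Rational.Unnormalised.Properties as ℚᵘ
  open import Algebra.Bundles using (Ring)
  open import Algebra.Definitions.RawSemiring +-*-rawSemiring using (product; _^_)
  open import Algebra.Properties.Monoid.Sum ℚ.*-1-monoid
    using () renaming (sum-cong-≗ to product-cong; sum-replicate to product-replicate)
  open import Algebra.Properties.Semiring.Sum (Ring.semiring ℚ.+-*-ring)
    using (sum; sum-cong-≗; sum-replicate-zero; ∑-distrib-+; *-distribˡ-sum)
  open import Function using (_∘_)
  open import Relation.Nullary using (does; yes; no; contradiction)
  open import Relation.Nullary.Decidable using (dec⇒maybe)
  open import Relation.Binary.PropositionalEquality
  open ≡-Reasoning
  open import Tactic.RingSolver using (solve-∀)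
  open import Tactic.RingSolver.Core.AlmostCommutativeRing using (AlmostCommutativeRing; fromCommutativeRing)
  open import Defs using (Matrix; det)

  ℚ-ring : AlmostCommutativeRing _ _
  ℚ-ring = fromCommutativeRing ℚ.+-*-commutativeRing (λ x → dec⇒maybe (0ℚ ℚ.≟ x))

  private
    variable
      n : ℕ

  sum-linear : (α β : ℚ) (f g : Fin n → ℚ) → sum (λ i → α * f i + β * g i) ≡ α * sum f + β * sum g
  sum-linear α β f g = trans (∑-distrib-+ (λ i → α * f i) (λ i → β * g i))
                             (sym (cong₂ _+_ (*-distribˡ-sum α f) (*-distribˡ-sum β g)))

  sum-neg : (f : Fin n → ℚ) → sum (λ i → - f i) ≡ - sum f
  sum-neg {zero}  f = refl
  sum-neg {suc n} f = trans (cong (- f zero +_) (sum-neg (f ∘ suc))) (sym (ℚ.neg-distrib-+ (f zero) _))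

  sum-zero : (f : Fin n → ℚ) → (∀ i → f i ≡ 0ℚ) → sum f ≡ 0ℚ
  sum-zero {n} f f≡0 = trans (sum-cong-≗ f≡0) (sum-replicate-zero n)

  sum-split : ∀ {m n} (f : Fin (m ℕ.+ n) → ℚ) → sum f ≡ sum (f ∘ (_↑ˡ n)) + sum (f ∘ (m ↑ʳ_))
  sum-split {zero}  f = sym (ℚ.+-identityˡ (sum f))
  sum-split {suc m} {n} f =
    trans (cong (f zero +_) (sum-split {m} {n} (f ∘ suc))) (sym (ℚ.+-assoc (f zero) _ _))

  product-split : ∀ {m n} (f : Fin (m ℕ.+ n) → ℚ) →
    product f ≡ product (f ∘ (_↑ˡ n)) * product (f ∘ (m ↑ʳ_))
  product-split {zero}  f = sym (ℚ.*-identityˡ (product f))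
  product-split {suc m} {n} f =
    trans (cong (f zero *_) (product-split {m} {n} (f ∘ suc))) (sym (ℚ.*-assoc (f zero) _ _))

  ι : ℕ → ℚ
  ι n = ℤ.+ n / 1

  -- The arithmetic of ι is checked on unnormalised representatives, where it is integer arithmetic.
  private
    toℚᵘ-/ : ∀ a b → toℚᵘ (ℤ.+ a / suc b) ≃ mkℚᵘ (ℤ.+ a) b
    toℚᵘ-/ a b = ℚ.toℚᵘ-fromℚᵘ (mkℚᵘ (ℤ.+ a) b)

  ι-+ : ∀ m n → ι (m ℕ.+ n) ≡ ι m + ι n
  ι-+ m n = ℚ.toℚᵘ-injective
    (ℚᵘ.≃-trans (toℚᵘ-/ (m ℕ.+ n) 0)
      (ℚᵘ.≃-sym (ℚᵘ.≃-trans (ℚ.toℚᵘ-homo-+ (ι m) (ι n))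
                  (ℚᵘ.≃-trans (ℚᵘ.+-cong (toℚᵘ-/ m 0) (toℚᵘ-/ n 0)) (*≡* numerators)))))
    where
    numerators : (ℤ.+ m ℤ.* ℤ.+ 1 ℤ.+ ℤ.+ n ℤ.* ℤ.+ 1) ℤ.* ℤ.+ 1 ≡ ℤ.+ (m ℕ.+ n) ℤ.* ℤ.+ 1
    numerators = trans (unit-denominators (ℤ.+ m) (ℤ.+ n)) (cong (ℤ._* ℤ.+ 1) (sym (ℤ.pos-+ m n)))
      where
      unit-denominators : ∀ x y → (x ℤ.* ℤ.+ 1 ℤ.+ y ℤ.* ℤ.+ 1) ℤ.* ℤ.+ 1 ≡ (x ℤ.+ y) ℤ.* ℤ.+ 1
      unit-denominators = ℤ-Solver.solve-∀

  ι-* : ∀ m n → ι (m ℕ.* n) ≡ ι m * ι n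
  ι-* m n = ℚ.toℚᵘ-injective
    (ℚᵘ.≃-trans (toℚᵘ-/ (m ℕ.* n) 0)
      (ℚᵘ.≃-sym (ℚᵘ.≃-trans (ℚ.toℚᵘ-homo-* (ι m) (ι n))
                  (ℚᵘ.≃-trans (ℚᵘ.*-cong (toℚᵘ-/ m 0) (toℚᵘ-/ n 0)) (*≡* numerators)))))
    where
    numerators : (ℤ.+ m ℤ.* ℤ.+ n) ℤ.* ℤ.+ 1 ≡ ℤ.+ (m ℕ.* n) ℤ.* ℤ.+ 1
    numerators = cong (ℤ._* ℤ.+ 1) (sym (ℤ.pos-* m n))

  /-*-ι : ∀ a d .{{_ : NonZero d}} → (ℤ.+ a / d) * ι d ≡ ι a
  /-*-ι a (suc b) = ℚ.toℚᵘ-injective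
    (ℚᵘ.≃-trans (ℚ.toℚᵘ-homo-* (ℤ.+ a / suc b) (ι (suc b)))
      (ℚᵘ.≃-trans (ℚᵘ.*-cong (toℚᵘ-/ a b) (toℚᵘ-/ (suc b) 0))
        (ℚᵘ.≃-trans (*≡* numerators) (ℚᵘ.≃-sym (toℚᵘ-/ a 0)))))
    where
    numerators : (ℤ.+ a ℤ.* ℤ.+ suc b) ℤ.* ℤ.+ 1 ≡ ℤ.+ a ℤ.* ℤ.+ suc (b ℕ.* 1)
    numerators rewrite ℕ.*-identityʳ b = ℤ.*-identityʳ (ℤ.+ a ℤ.* ℤ.+ suc b)

  sum-constant : (f : Fin n → ℚ) {x : ℚ} → (∀ i → f i ≡ x) → sum f ≡ ι n * x
  sum-constant {zero}  f {x} f≡x = sym (ℚ.*-zeroˡ x)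
  sum-constant {suc n} f {x} f≡x = begin
    f zero + sum (f ∘ suc)   ≡⟨ cong₂ _+_ (f≡x zero) (sum-constant (f ∘ suc) (f≡x ∘ suc)) ⟩
    x + ι n * x              ≡⟨ one-more x (ι n) ⟩
    (1ℚ + ι n) * x           ≡⟨ cong (_* x) (ι-+ 1 n) ⟨
    ι (suc n) * x            ∎
    where
    one-more : ∀ x t → x + t * x ≡ (1ℚ + t) * x
    one-more = solve-∀ ℚ-ring

  product-constant : (f : Fin n → ℚ) {x : ℚ} → (∀ i → f i ≡ x) → product f ≡ x ^ n
  product-constant {n} f f≡x = trans (product-cong f≡x) (product-replicate n)

  sign : ℕ → ℚ
  sign zero    = 1ℚ
  sign (suc k) = - sign k

  minor : Matrix (suc n) → Fin (suc n) → Matrix n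
  minor M j r c = M (suc r) (punchIn j c)

  laplaceTerm : Matrix (suc n) → Fin (suc n) → ℚ
  laplaceTerm M j = sign (toℕ j) * M zero j * det (minor M j)

  laplaceRow : Matrix (suc n) → List (Fin (suc n)) → ℚ → ℚ
  laplaceRow M []       s = 0ℚ
  laplaceRow M (j ∷ js) s = s * M zero j * det (minor M j) + laplaceRow M js (- s)

  laplaceRow-unique : (M : Matrix (suc n)) (G : List (Fin (suc n)) → ℚ → ℚ) →
    (∀ s → G [] s ≡ 0ℚ) →
    (∀ j js s → G (j ∷ js) s ≡ s * M zero j * det (minor M j) + G js (- s)) →
    ∀ js s → G js s ≡ laplaceRow M js s
  laplaceRow-unique M G G[] G∷ []       s = G[] s
  laplaceRow-unique M G G[] G∷ (j ∷ js) s =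
    trans (G∷ j js s) (cong (s * M zero j * det (minor M j) +_) (laplaceRow-unique M G G[] G∷ js (- s)))

  -- det expands along the first row through a function local to Defs, which cannot be
  -- named; once its arguments are generalised, unification solves G to be that function.
  det≡laplaceRow : (M : Matrix (suc n)) → det M ≡ laplaceRow M (allFin (suc n)) 1ℚ
  det≡laplaceRow {n} M = expansion
    where
    G : List (Fin (suc n)) → ℚ → ℚ
    G = _
    expansion : det M ≡ laplaceRow M (allFin (suc n)) 1ℚ
    expansion with tabulate {n = n} (λ (i : Fin n) → suc i) | - 1ℚ
    ... | js | s = cong (1ℚ * M zero zero * det (minor M zero) +_)
                        (laplaceRow-unique M G (λ _ → refl) (λ _ _ _ → refl) js s)

  laplaceRow-tabulate : (M : Matrix (suc n)) {k : ℕ} (g : Fin k → Fin (suc n)) (m : ℕ) →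
    laplaceRow M (tabulate g) (sign m) ≡ sum (λ i → sign (m ℕ.+ toℕ i) * M zero (g i) * det (minor M (g i)))
  laplaceRow-tabulate M {zero}  g m = refl
  laplaceRow-tabulate M {suc k} g m = cong₂ _+_
    (cong (λ t → signed t (g zero)) (sym (ℕ.+-identityʳ m)))
    (trans (laplaceRow-tabulate M (g ∘ suc) (suc m))
           (sum-cong-≗ λ i → cong (λ t → signed t (g (suc i))) (sym (ℕ.+-suc m (toℕ i)))))
    where
    signed : ℕ → Fin (suc _) → ℚ
    signed t j = sign t * M zero j * det (minor M j)

  det-expansion : (M : Matrix (suc n)) → det M ≡ sum (laplaceTerm M)
  det-expansion M = trans (det≡laplaceRow M) (laplaceRow-tabulate M (λ j → j) 0)

  det-cong : {M N : Matrix n} → (∀ r c → M r c ≡ N r c) → det M ≡ det N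
  det-cong {zero}          _   = refl
  det-cong {suc n} {M} {N} M≡N = begin
    det M               ≡⟨ det-expansion M ⟩
    sum (laplaceTerm M) ≡⟨ sum-cong-≗ term ⟩
    sum (laplaceTerm N) ≡⟨ det-expansion N ⟨
    det N               ∎
    where
    term : ∀ j → laplaceTerm M j ≡ laplaceTerm N j
    term j = cong₂ (λ x d → sign (toℕ j) * x * d) (M≡N zero j) (det-cong λ r c → M≡N (suc r) (punchIn j c))

  det-from-first-term : (M : Matrix (suc n)) → (∀ i → laplaceTerm M (suc i) ≡ 0ℚ) →
    det M ≡ M zero zero * det (minor M zero)
  det-from-first-term M tail≡0 = begin
    det M                                           ≡⟨ det-expansion M ⟩
    laplaceTerm M zero + sum (laplaceTerm M ∘ suc)  ≡⟨ cong (laplaceTerm M zero +_) (sum-zero _ tail≡0) ⟩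
    laplaceTerm M zero + 0ℚ                         ≡⟨ first (M zero zero) (det (minor M zero)) ⟩
    M zero zero * det (minor M zero)                ∎
    where
    first : ∀ x d → 1ℚ * x * d + 0ℚ ≡ x * d
    first = solve-∀ ℚ-ring

  det-from-first-entry : (M : Matrix (suc n)) → (∀ i → M zero (suc i) ≡ 0ℚ) →
    det M ≡ M zero zero * det (minor M zero)
  det-from-first-entry M row≡0 = det-from-first-term M λ i →
    trans (cong (λ x → sign (toℕ (suc i)) * x * det (minor M (suc i))) (row≡0 i))
          (vanish (sign (toℕ (suc i))) (det (minor M (suc i))))
    where
    vanish : ∀ s d → s * 0ℚ * d ≡ 0ℚ
    vanish = solve-∀ ℚ-ring

  det-linear-column : (c : Fin n) {A B C : Matrix n} (α β : ℚ) →
    (∀ r k → k ≢ c → B r k ≡ A r k) → (∀ r k → k ≢ c → C r k ≡ A r k) →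
    (∀ r → A r c ≡ α * B r c + β * C r c) →
    det A ≡ α * det B + β * det C
  det-linear-column {suc n} c {A} {B} {C} α β B≈A C≈A Ac = begin
    det A                                                 ≡⟨ det-expansion A ⟩
    sum (laplaceTerm A)                                   ≡⟨ sum-cong-≗ term ⟩
    sum (λ j → α * laplaceTerm B j + β * laplaceTerm C j) ≡⟨ sum-linear α β (laplaceTerm B) (laplaceTerm C) ⟩
    α * sum (laplaceTerm B) + β * sum (laplaceTerm C)
      ≡⟨ cong₂ (λ x y → α * x + β * y) (det-expansion B) (det-expansion C) ⟨
    α * det B + β * det C                                 ∎
    where
    spread : ∀ s a b x y d → s * (a * x + b * y) * d ≡ a * (s * x * d) + b * (s * y * d)
    spread = solve-∀ ℚ-ring
    factor : ∀ s a b x d e → s * x * (a * d + b * e) ≡ a * (s * x * d) + b * (s * x * e)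
    factor = solve-∀ ℚ-ring
    term : ∀ j → laplaceTerm A j ≡ α * laplaceTerm B j + β * laplaceTerm C j
    term j with j ≟ c
    ... | yes refl = begin
      s * A zero j * det (minor A j)                        ≡⟨ cong₂ (λ x d → s * x * d) (Ac zero) (det-cong A≈B) ⟩
      s * (α * B zero j + β * C zero j) * det (minor B j)   ≡⟨ spread s α β (B zero j) (C zero j) (det (minor B j)) ⟩
      α * (s * B zero j * det (minor B j)) + β * (s * C zero j * det (minor B j))
        ≡⟨ cong (λ d → α * (s * B zero j * det (minor B j)) + β * (s * C zero j * d)) (det-cong B≈C) ⟩
      α * laplaceTerm B j + β * laplaceTerm C j             ∎
      where
      s = sign (toℕ j)
      A≈B : ∀ r k → minor A j r k ≡ minor B j r k
      A≈B r k = sym (B≈A (suc r) (punchIn j k) (punchInᵢ≢i j k))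
      B≈C : ∀ r k → minor B j r k ≡ minor C j r k
      B≈C r k = trans (sym (A≈B r k)) (sym (C≈A (suc r) (punchIn j k) (punchInᵢ≢i j k)))
    ... | no j≢c = begin
      s * A zero j * det (minor A j)                              ≡⟨ cong (s * A zero j *_) minor-linear ⟩
      s * A zero j * (α * det (minor B j) + β * det (minor C j))  ≡⟨ factor s α β (A zero j) _ _ ⟩
      α * (s * A zero j * det (minor B j)) + β * (s * A zero j * det (minor C j))
        ≡⟨ cong₂ (λ x y → α * (s * x * det (minor B j)) + β * (s * y * det (minor C j)))
                 (B≈A zero j j≢c) (C≈A zero j j≢c) ⟨
      α * laplaceTerm B j + β * laplaceTerm C j                   ∎
      where
      s = sign (toℕ j)
      c′ = punchOut j≢c
      avoids-c : ∀ {k} → k ≢ c′ → punchIn j k ≢ c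
      avoids-c k≢c′ eq = k≢c′ (punchIn-injective j _ c′ (trans eq (sym (punchIn-punchOut j≢c))))
      minor-linear : det (minor A j) ≡ α * det (minor B j) + β * det (minor C j)
      minor-linear = det-linear-column c′ α β
        (λ r k k≢c′ → B≈A (suc r) (punchIn j k) (avoids-c k≢c′))
        (λ r k k≢c′ → C≈A (suc r) (punchIn j k) (avoids-c k≢c′))
        (λ r → subst (λ k → A (suc r) k ≡ α * B (suc r) k + β * C (suc r) k)
                     (sym (punchIn-punchOut j≢c)) (Ac (suc r)))

  det-zero-column : (c : Fin n) (M : Matrix n) → (∀ r → M r c ≡ 0ℚ) → det M ≡ 0ℚ
  det-zero-column c M Mc≡0 = trans
    (det-linear-column c 0ℚ 0ℚ (λ _ _ _ → refl) (λ _ _ _ → refl) λ r → trans (Mc≡0 r) (sym (zero-combination (M r c))))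
    (zero-combination (det M))
    where
    zero-combination : ∀ x → 0ℚ * x + 0ℚ * x ≡ 0ℚ
    zero-combination = solve-∀ ℚ-ring

  det-minor-col₀≡0 : (M : Matrix (suc n)) (i : Fin n) → (∀ r → M (suc r) zero ≡ 0ℚ) →
    det (minor M (suc i)) ≡ 0ℚ
  det-minor-col₀≡0 {suc n} M i col₀≡0 = det-zero-column zero (minor M (suc i)) col₀≡0

  swapAt : Fin n → Fin (suc n) → Fin (suc n)
  swapAt zero    zero          = suc zero
  swapAt zero    (suc zero)    = zero
  swapAt zero    (suc (suc k)) = suc (suc k)
  swapAt (suc c) zero          = zero
  swapAt (suc c) (suc k)       = suc (swapAt c k)

  swapAt-inject₁ : (c : Fin n) → swapAt c (inject₁ c) ≡ suc c
  swapAt-inject₁ zero    = refl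
  swapAt-inject₁ (suc c) = cong suc (swapAt-inject₁ c)

  swapAt-suc : (c : Fin n) → swapAt c (suc c) ≡ inject₁ c
  swapAt-suc zero    = refl
  swapAt-suc (suc c) = cong suc (swapAt-suc c)

  swapAt-punchIn-inject₁ : (c k : Fin n) → swapAt c (punchIn (inject₁ c) k) ≡ punchIn (suc c) k
  swapAt-punchIn-inject₁ zero    zero    = refl
  swapAt-punchIn-inject₁ zero    (suc k) = refl
  swapAt-punchIn-inject₁ (suc c) zero    = refl
  swapAt-punchIn-inject₁ (suc c) (suc k) = cong suc (swapAt-punchIn-inject₁ c k)

  swapAt-punchIn-suc : (c k : Fin n) → swapAt c (punchIn (suc c) k) ≡ punchIn (inject₁ c) k
  swapAt-punchIn-suc zero    zero    = refl
  swapAt-punchIn-suc zero    (suc k) = refl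
  swapAt-punchIn-suc (suc c) zero    = refl
  swapAt-punchIn-suc (suc c) (suc k) = cong suc (swapAt-punchIn-suc c k)

  swapAt-apart : (c : Fin (suc n)) (j : Fin (suc (suc n))) → j ≢ inject₁ c → j ≢ suc c →
    swapAt c j ≡ j × Σ (Fin n) λ c′ → ∀ k → swapAt c (punchIn j k) ≡ punchIn j (swapAt c′ k)
  swapAt-apart         zero    zero          j≢c₁ _    = contradiction refl j≢c₁
  swapAt-apart         zero    (suc zero)    _    j≢c₂ = contradiction refl j≢c₂
  swapAt-apart {suc n} zero    (suc (suc j)) _    _    = refl , zero , commute
    where
    commute : ∀ k → swapAt zero (punchIn (suc (suc j)) k) ≡ punchIn (suc (suc j)) (swapAt zero k)
    commute zero          = refl
    commute (suc zero)    = refl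
    commute (suc (suc k)) = refl
  swapAt-apart         (suc c) zero          _    _    = refl , c , λ k → refl
  swapAt-apart {suc n} (suc c) (suc j)       j≢c₁ j≢c₂
    with swapAt-apart c j (j≢c₁ ∘ cong suc) (j≢c₂ ∘ cong suc)
  ... | fixed , c′ , commute = cong suc fixed , suc c′ , commute′
    where
    commute′ : ∀ k → swapAt (suc c) (punchIn (suc j) k) ≡ punchIn (suc j) (swapAt (suc c′) k)
    commute′ zero    = refl
    commute′ (suc k) = cong suc (commute k)

  sum-swapAt : (c : Fin n) (f : Fin (suc n) → ℚ) → sum (f ∘ swapAt c) ≡ sum f
  sum-swapAt zero    f = exchange (f (suc zero)) (f zero) _
    where
    exchange : ∀ a b r → a + (b + r) ≡ b + (a + r)
    exchange = solve-∀ ℚ-ring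
  sum-swapAt (suc c) f = cong (f zero +_) (sum-swapAt c (f ∘ suc))

  det-swapAt : (c : Fin n) (M : Matrix (suc n)) → det (λ r k → M r (swapAt c k)) ≡ - det M
  det-swapAt {suc n} c M = begin
    det M′                                    ≡⟨ det-expansion M′ ⟩
    sum (laplaceTerm M′)                      ≡⟨ sum-cong-≗ term ⟩
    sum (λ j → - laplaceTerm M (swapAt c j))  ≡⟨ sum-neg (laplaceTerm M ∘ swapAt c) ⟩
    - sum (laplaceTerm M ∘ swapAt c)          ≡⟨ cong -_ (sum-swapAt c (laplaceTerm M)) ⟩
    - sum (laplaceTerm M)                     ≡⟨ cong -_ (det-expansion M) ⟨
    - det M                                   ∎
    where
    M′ : Matrix (suc (suc n))
    M′ r k = M r (swapAt c k)
    double-neg : ∀ s x d → s * x * d ≡ - (- s * x * d)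
    double-neg = solve-∀ ℚ-ring
    neg-out : ∀ s x d → - s * x * d ≡ - (s * x * d)
    neg-out = solve-∀ ℚ-ring
    term : ∀ j → laplaceTerm M′ j ≡ - laplaceTerm M (swapAt c j)
    term j with j ≟ inject₁ c | j ≟ suc c
    ... | yes refl | _ rewrite swapAt-inject₁ c = begin
      sign (toℕ (inject₁ c)) * M zero (suc c) * det (minor M′ (inject₁ c))
        ≡⟨ cong₂ (λ s d → s * M zero (suc c) * d) (cong sign (toℕ-inject₁ c))
                 (det-cong λ r k → cong (M (suc r)) (swapAt-punchIn-inject₁ c k)) ⟩
      sign (toℕ c) * M zero (suc c) * det (minor M (suc c))
        ≡⟨ double-neg (sign (toℕ c)) _ _ ⟩
      - laplaceTerm M (suc c) ∎
    ... | no _ | yes refl rewrite swapAt-suc c = begin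
      - sign (toℕ c) * M zero (inject₁ c) * det (minor M′ (suc c))
        ≡⟨ cong₂ (λ s d → - s * M zero (inject₁ c) * d) (cong sign (sym (toℕ-inject₁ c)))
                 (det-cong λ r k → cong (M (suc r)) (swapAt-punchIn-suc c k)) ⟩
      - sign (toℕ (inject₁ c)) * M zero (inject₁ c) * det (minor M (inject₁ c))
        ≡⟨ neg-out (sign (toℕ (inject₁ c))) _ _ ⟩
      - laplaceTerm M (inject₁ c) ∎
    ... | no j≢c₁ | no j≢c₂ with swapAt-apart c j j≢c₁ j≢c₂
    ...   | fixed , c′ , commute rewrite fixed = begin
      sign (toℕ j) * M zero j * det (minor M′ j)
        ≡⟨ cong (sign (toℕ j) * M zero j *_) (det-cong λ r k → cong (M (suc r)) (commute k)) ⟩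
      sign (toℕ j) * M zero j * det (λ r k → minor M j r (swapAt c′ k))
        ≡⟨ cong (sign (toℕ j) * M zero j *_) (det-swapAt c′ (minor M j)) ⟩
      sign (toℕ j) * M zero j * - det (minor M j)
        ≡⟨ ℚ.neg-distribʳ-* (sign (toℕ j) * M zero j) (det (minor M j)) ⟨
      - laplaceTerm M j ∎

  x≡-x⇒x≡0 : ∀ {x} → x ≡ - x → x ≡ 0ℚ
  x≡-x⇒x≡0 {x} x≡-x = begin
    x              ≡⟨ half-of-double x ⟩
    ½ * (x + x)    ≡⟨ cong (λ y → ½ * (x + y)) x≡-x ⟩
    ½ * (x + - x)  ≡⟨ cong (½ *_) (ℚ.+-inverseʳ x) ⟩
    ½ * 0ℚ         ≡⟨ ℚ.*-zeroʳ ½ ⟩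
    0ℚ             ∎
    where
    half-of-double : ∀ x → x ≡ ½ * (x + x)
    half-of-double = solve-∀ ℚ-ring

  -- Column suc k is moved next to column 0 by adjacent transpositions.
  det-col₀≡col⇒0 : (k : Fin n) (M : Matrix (suc n)) → (∀ r → M r zero ≡ M r (suc k)) → det M ≡ 0ℚ
  det-col₀≡col⇒0 {suc n} = <-weakInduction Vanishes adjacent step
    where
    Vanishes : Fin (suc n) → Set
    Vanishes k = ∀ M → (∀ r → M r zero ≡ M r (suc k)) → det M ≡ 0ℚ
    adjacent : Vanishes zero
    adjacent M col₀≡col₁ = x≡-x⇒x≡0 (trans (det-cong unmoved) (det-swapAt zero M))
      where
      unmoved : ∀ r k → M r k ≡ M r (swapAt zero k)
      unmoved r zero          = col₀≡col₁ r
      unmoved r (suc zero)    = sym (col₀≡col₁ r)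
      unmoved r (suc (suc k)) = refl
    step : ∀ k → Vanishes (inject₁ k) → Vanishes (suc k)
    step k vanishes M col₀≡col = ℚ.neg-injective (begin
      - det M     ≡⟨ det-swapAt (suc k) M ⟨
      det M′      ≡⟨ vanishes M′ (λ r → trans (col₀≡col r) (cong (M r ∘ suc) (sym (swapAt-inject₁ k)))) ⟩
      0ℚ          ∎)
      where
      M′ : Matrix (suc (suc n))
      M′ r j = M r (swapAt (suc k) j)

  det-add-col₀ : (k : Fin n) (t : ℚ) {M N : Matrix (suc n)} →
    (∀ r j → j ≢ suc k → N r j ≡ M r j) → (∀ r → N r (suc k) ≡ M r (suc k) + t * M r zero) →
    det N ≡ det M
  det-add-col₀ k t {M} {N} N≈M Nk = begin
    det N                     ≡⟨ det-linear-column (suc k) 1ℚ t (λ r j j≢ → sym (N≈M r j j≢)) M₀≈N Nk′ ⟩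
    1ℚ * det M + t * det M₀   ≡⟨ cong (λ d → 1ℚ * det M + t * d) (det-col₀≡col⇒0 k M₀ (λ r → sym (M₀k r))) ⟩
    1ℚ * det M + t * 0ℚ       ≡⟨ drop-zero (det M) t ⟩
    det M                     ∎
    where
    M₀ : Matrix (suc _)
    M₀ r = updateAt (M r) (suc k) (λ _ → M r zero)
    M₀k : ∀ r → M₀ r (suc k) ≡ M r zero
    M₀k r = updateAt-updates (suc k) {λ _ → M r zero} (M r)
    M₀≈N : ∀ r j → j ≢ suc k → M₀ r j ≡ N r j
    M₀≈N r j j≢ = trans (updateAt-minimal j (suc k) (M r) j≢) (sym (N≈M r j j≢))
    Nk′ : ∀ r → N r (suc k) ≡ 1ℚ * M r (suc k) + t * M₀ r (suc k)
    Nk′ r = trans (Nk r) (cong₂ (λ x y → x + t * y) (sym (ℚ.*-identityˡ (M r (suc k)))) (sym (M₀k r)))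
    drop-zero : ∀ d t → 1ℚ * d + t * 0ℚ ≡ d
    drop-zero = solve-∀ ℚ-ring

  _+col₀_ : Matrix (suc n) → (Fin n → ℚ) → Matrix (suc n)
  (M +col₀ t) r zero    = M r zero
  (M +col₀ t) r (suc k) = M r (suc k) + t k * M r zero

  det-+col₀ : (M : Matrix (suc n)) (t : Fin n → ℚ) → det (M +col₀ t) ≡ det M
  det-+col₀ {n} M t = supported (allFin n) t (λ k k∉ → contradiction (∈-allFin k) k∉)
    where
    supported : ∀ ks t → (∀ k → k ∉ ks → t k ≡ 0ℚ) → det (M +col₀ t) ≡ det M
    supported []       t t≡0 = det-cong unchanged
      where
      unchanged : ∀ r j → (M +col₀ t) r j ≡ M r j
      unchanged r zero    = refl
      unchanged r (suc k) =
        trans (cong (λ s → M r (suc k) + s * M r zero) (t≡0 k λ ())) (add-zero (M r (suc k)) (M r zero))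
        where
        add-zero : ∀ x y → x + 0ℚ * y ≡ x
        add-zero = solve-∀ ℚ-ring
    supported (k ∷ ks) t t≡0 = trans (det-add-col₀ k (t k) agree column) (supported ks t′ t′≡0)
      where
      t′ : Fin _ → ℚ
      t′ = updateAt t k (λ _ → 0ℚ)
      agree : ∀ r j → j ≢ suc k → (M +col₀ t) r j ≡ (M +col₀ t′) r j
      agree r zero    _   = refl
      agree r (suc j) j≢ =
        cong (λ s → M r (suc j) + s * M r zero) (sym (updateAt-minimal j k t (j≢ ∘ cong suc)))
      column : ∀ r → (M +col₀ t) r (suc k) ≡ (M +col₀ t′) r (suc k) + t k * M r zero
      column r rewrite updateAt-updates k {λ _ → 0ℚ} t = add-zero (M r (suc k)) (t k) (M r zero)
        where
        add-zero : ∀ x s y → x + s * y ≡ x + 0ℚ * y + s * y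
        add-zero = solve-∀ ℚ-ring
      t′≡0 : ∀ j → j ∉ ks → t′ j ≡ 0ℚ
      t′≡0 j j∉ with j ≟ k
      ... | yes refl = updateAt-updates j t
      ... | no j≢k   = trans (updateAt-minimal j k t j≢k) (t≡0 j j∉k∷ks)
        where
        j∉k∷ks : j ∉ k ∷ ks
        j∉k∷ks (here j≡k)  = j≢k j≡k
        j∉k∷ks (there j∈ks) = j∉ j∈ks

  diagonal : (Fin n → ℚ) → Matrix n
  diagonal a r c = if does (r ≟ c) then a c else 0ℚ

  sum-diagonal : (a f : Fin n → ℚ) (k : Fin n) → sum (λ j → diagonal a k j * f j) ≡ a k * f k
  sum-diagonal {suc n} a f zero    =
    trans (cong (a zero * f zero +_) (sum-zero _ (λ j → ℚ.*-zeroˡ (f (suc j))))) (ℚ.+-identityʳ _)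
  sum-diagonal {suc n} a f (suc k) =
    trans (cong₂ _+_ (ℚ.*-zeroˡ (f zero)) (sum-diagonal (tail a) (tail f) k)) (ℚ.+-identityˡ _)

  diagonal-shift : (x : ℚ) (a : Fin n → ℚ) (e : ℚ) (r c : Fin n) →
    (if does (r ≟ c) then x else 0ℚ) - (diagonal a r c - e) ≡ diagonal (λ i → x - a i) r c + e
  diagonal-shift x a e r c with does (r ≟ c)
  ... | true  = on-diagonal x (a c) e
    where
    on-diagonal : ∀ x w e → x - (w - e) ≡ x - w + e
    on-diagonal = solve-∀ ℚ-ring
  ... | false = off-diagonal e
    where
    off-diagonal : ∀ e → 0ℚ - (0ℚ - e) ≡ 0ℚ + e
    off-diagonal = solve-∀ ℚ-ring

  det-diagonal : (a : Fin n → ℚ) → det (diagonal a) ≡ product a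
  det-diagonal {zero}  a = refl
  det-diagonal {suc n} a =
    trans (det-from-first-entry (diagonal a) (λ _ → refl)) (cong (a zero *_) (det-diagonal (tail a)))

  -- vᵀ adj(diag a) u = Σₖ uₖ vₖ ∏_{j ≠ k} aⱼ
  adjugateForm : (a u v : Fin n → ℚ) → ℚ
  adjugateForm {zero}  a u v = 0ℚ
  adjugateForm {suc n} a u v =
    u zero * v zero * product (tail a) + a zero * adjugateForm (tail a) (tail u) (tail v)

  det-unit-col₀ : (M : Matrix (suc n)) → M zero zero ≡ 1ℚ → (∀ r → M (suc r) zero ≡ 0ℚ) →
    det M ≡ det (minor M zero)
  det-unit-col₀ M M₀₀≡1 col₀≡0 = begin
    det M                           ≡⟨ det-from-first-term M vanish ⟩
    M zero zero * det (minor M zero) ≡⟨ cong (_* det (minor M zero)) M₀₀≡1 ⟩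
    1ℚ * det (minor M zero)         ≡⟨ ℚ.*-identityˡ _ ⟩
    det (minor M zero)              ∎
    where
    vanish : ∀ i → laplaceTerm M (suc i) ≡ 0ℚ
    vanish i = trans (cong (sign (toℕ (suc i)) * M zero (suc i) *_) (det-minor-col₀≡0 M i col₀≡0))
                     (ℚ.*-zeroʳ (sign (toℕ (suc i)) * M zero (suc i)))

  det-shifted-diagonal+col₀ : (u a : Fin (suc n) → ℚ) (t : Fin n → ℚ) {C : Matrix (suc n)} →
    (∀ r → C r zero ≡ u r) → (∀ r k → C r (suc k) ≡ diagonal a r (suc k) + u r * t k) →
    det C ≡ u zero * product (tail a)
  det-shifted-diagonal+col₀ u a t {C} C₀ Cₖ = begin
    det C                             ≡⟨ det-cong C≈D+col₀t ⟩
    det (D +col₀ t)                   ≡⟨ det-+col₀ D t ⟩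
    det D                             ≡⟨ det-from-first-entry D (λ _ → refl) ⟩
    u zero * det (diagonal (tail a))  ≡⟨ cong (u zero *_) (det-diagonal (tail a)) ⟩
    u zero * product (tail a)         ∎
    where
    D : Matrix (suc _)
    D r zero    = u r
    D r (suc k) = diagonal a r (suc k)
    C≈D+col₀t : ∀ r k → C r k ≡ (D +col₀ t) r k
    C≈D+col₀t r zero    = C₀ r
    C≈D+col₀t r (suc k) = trans (Cₖ r k) (cong (diagonal a r (suc k) +_) (ℚ.*-comm (u r) (t k)))

  det-diagonal+rankOne : (a u v : Fin n → ℚ) {A : Matrix n} →
    (∀ r c → A r c ≡ diagonal a r c + u r * v c) → det A ≡ product a + adjugateForm a u v
  det-diagonal+rankOne {zero}  a u v A≡ = sym (ℚ.+-identityʳ 1ℚ)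
  det-diagonal+rankOne {suc n} a u v {A} A≡ = begin
    det A                                             ≡⟨ det-linear-column zero (a zero) (v zero) B≈A C≈A split ⟩
    a zero * det B + v zero * det C                   ≡⟨ cong₂ (λ x y → a zero * x + v zero * y) det-B det-C ⟩
    a zero * (P + R) + v zero * (u zero * P)          ≡⟨ regroup (a zero) (v zero) (u zero) P R ⟩
    a zero * P + (u zero * v zero * P + a zero * R)   ∎
    where
    P = product (tail a)
    R = adjugateForm (tail a) (tail u) (tail v)
    regroup : ∀ a v u P R → a * (P + R) + v * (u * P) ≡ a * P + (u * v * P + a * R)
    regroup = solve-∀ ℚ-ring
    B C : Matrix (suc n)
    B r zero    = diagonal (λ _ → 1ℚ) r zero
    B r (suc k) = A r (suc k)
    C r zero    = u r
    C r (suc k) = A r (suc k)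
    B≈A : ∀ r k → k ≢ zero → B r k ≡ A r k
    B≈A r zero    k≢0 = contradiction refl k≢0
    B≈A r (suc k) _   = refl
    C≈A : ∀ r k → k ≢ zero → C r k ≡ A r k
    C≈A r zero    k≢0 = contradiction refl k≢0
    C≈A r (suc k) _   = refl
    split : ∀ r → A r zero ≡ a zero * B r zero + v zero * C r zero
    split zero    = trans (A≡ zero zero) (on-diagonal (a zero) (u zero) (v zero))
      where
      on-diagonal : ∀ a u v → a + u * v ≡ a * 1ℚ + v * u
      on-diagonal = solve-∀ ℚ-ring
    split (suc r) = trans (A≡ (suc r) zero) (off-diagonal (a zero) (u (suc r)) (v zero))
      where
      off-diagonal : ∀ a u v → 0ℚ + u * v ≡ a * 0ℚ + v * u
      off-diagonal = solve-∀ ℚ-ring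
    det-B : det B ≡ P + R
    det-B = trans (det-unit-col₀ B refl (λ _ → refl))
                  (det-diagonal+rankOne (tail a) (tail u) (tail v) (λ r c → A≡ (suc r) (suc c)))
    det-C : det C ≡ u zero * P
    det-C = det-shifted-diagonal+col₀ u a (tail v) {C} (λ _ → refl) (λ r k → A≡ r (suc k))

  adjugateForm-split : ∀ {m n} (a u v : Fin (m ℕ.+ n) → ℚ) →
    adjugateForm a u v ≡ adjugateForm (a ∘ (_↑ˡ n)) (u ∘ (_↑ˡ n)) (v ∘ (_↑ˡ n)) * product (a ∘ (m ↑ʳ_))
                         + product (a ∘ (_↑ˡ n)) * adjugateForm (a ∘ (m ↑ʳ_)) (u ∘ (m ↑ʳ_)) (v ∘ (m ↑ʳ_))
  adjugateForm-split {zero}      a u v = absorb (product a) (adjugateForm a u v)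
    where
    absorb : ∀ P R → R ≡ 0ℚ * P + 1ℚ * R
    absorb = solve-∀ ℚ-ring
  adjugateForm-split {suc m} {n} a u v = begin
    u zero * v zero * product (tail a) + a zero * adjugateForm (tail a) (tail u) (tail v)
      ≡⟨ cong₂ (λ P R → u zero * v zero * P + a zero * R)
               (product-split {m} {n} (tail a)) (adjugateForm-split {m} {n} (tail a) (tail u) (tail v)) ⟩
    u zero * v zero * (P₁ * P₂) + a zero * (R₁ * P₂ + P₁ * R₂)
      ≡⟨ regroup (u zero) (v zero) (a zero) P₁ P₂ R₁ R₂ ⟩
    (u zero * v zero * P₁ + a zero * R₁) * P₂ + a zero * P₁ * R₂ ∎
    where
    P₁ = product (tail a ∘ (_↑ˡ n))
    P₂ = product (a ∘ (suc m ↑ʳ_))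
    R₁ = adjugateForm (tail a ∘ (_↑ˡ n)) (tail u ∘ (_↑ˡ n)) (tail v ∘ (_↑ˡ n))
    R₂ = adjugateForm (a ∘ (suc m ↑ʳ_)) (u ∘ (suc m ↑ʳ_)) (v ∘ (suc m ↑ʳ_))
    regroup : ∀ u v a P₁ P₂ R₁ R₂ →
      u * v * (P₁ * P₂) + a * (R₁ * P₂ + P₁ * R₂) ≡ (u * v * P₁ + a * R₁) * P₂ + a * P₁ * R₂
    regroup = solve-∀ ℚ-ring

  adjugateForm-cong : {a a′ u u′ v v′ : Fin n → ℚ} →
    (∀ i → a i ≡ a′ i) → (∀ i → u i ≡ u′ i) → (∀ i → v i ≡ v′ i) → adjugateForm a u v ≡ adjugateForm a′ u′ v′
  adjugateForm-cong {zero}  _   _   _   = refl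
  adjugateForm-cong {suc n} a≗ u≗ v≗ = cong₂ _+_
    (cong₂ _*_ (cong₂ _*_ (u≗ zero) (v≗ zero)) (product-cong (a≗ ∘ suc)))
    (cong₂ _*_ (a≗ zero) (adjugateForm-cong (a≗ ∘ suc) (u≗ ∘ suc) (v≗ ∘ suc)))

  adjugateForm-constant : ∀ q (a u v : ℚ) →
    adjugateForm {suc q} (λ _ → a) (λ _ → u) (λ _ → v) ≡ ι (suc q) * (u * v) * a ^ q
  adjugateForm-constant zero    a u v = one-term (u * v) a
    where
    one-term : ∀ e a → e * 1ℚ + a * 0ℚ ≡ 1ℚ * e * 1ℚ
    one-term = solve-∀ ℚ-ring
  adjugateForm-constant (suc q) a u v = begin
    u * v * product {suc q} (λ _ → a) + a * adjugateForm {suc q} (λ _ → a) (λ _ → u) (λ _ → v)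
      ≡⟨ cong₂ (λ P R → u * v * P + a * R) (product-replicate (suc q) {a}) (adjugateForm-constant q a u v) ⟩
    u * v * (a * a ^ q) + a * (ι (suc q) * (u * v) * a ^ q)
      ≡⟨ one-more (u * v) a (a ^ q) (ι (suc q)) ⟩
    (1ℚ + ι (suc q)) * (u * v) * (a * a ^ q)
      ≡⟨ cong (λ t → t * (u * v) * (a * a ^ q)) (ι-+ 1 (suc q)) ⟨
    ι (suc (suc q)) * (u * v) * (a * a ^ q) ∎
    where
    one-more : ∀ e a X t → e * (a * X) + a * (t * e * X) ≡ (1ℚ + t) * e * (a * X)
    one-more = solve-∀ ℚ-ring

module Spectrum where

  open import Data.Nat using (ℕ; zero; suc; pred; _∸_; _≤_; s≤s; z≤n; NonZero)
  import Data.Nat as ℕ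
  import Data.Nat.Properties as ℕ
  open import Data.Integer as ℤ using (1ℤ)
  open import Data.List using (List; []; _∷_; map; replicate; _++_)
  open import Data.Product using (Σ; _,_)
  open import Data.Rational using (ℚ; 0ℚ; 1ℚ; _+_; _*_; _-_; _/_; +-*-rawSemiring)
  import Data.Rational.Properties as ℚ
  open import Algebra.Definitions.RawSemiring +-*-rawSemiring using (_^_)
  open import Relation.Binary.PropositionalEquality
  open ≡-Reasoning
  open import Tactic.RingSolver using (solve-∀)
  open import Defs using (prodℚ; midEig; spiderSpectrum)
  open Determinant

  -- 1/ℓ for a leg of length ℓ, which Defs takes to have suc (pred ℓ) edges.
  legWeight : ℕ → ℚ
  legWeight ℓ = 1ℤ / suc (pred ℓ)

  legWeight-length : ∀ ℓ → legWeight ℓ * ι (suc (pred ℓ)) ≡ 1ℚ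
  legWeight-length ℓ = /-*-ι 1 (suc (pred ℓ))

  totalWeight : (p₁ p₂ ℓ₁ ℓ₂ : ℕ) → ℚ
  totalWeight p₁ p₂ ℓ₁ ℓ₂ = ι p₁ * legWeight ℓ₁ + ι p₂ * legWeight ℓ₂

  weightDenominator : (p₁ p₂ ℓ₁ ℓ₂ : ℕ) → ℕ
  weightDenominator p₁ p₂ ℓ₁ ℓ₂ = suc (pred ℓ₂) ℕ.* p₁ ℕ.+ suc (pred ℓ₁) ℕ.* p₂

  totalWeight-denominator : ∀ p₁ p₂ ℓ₁ ℓ₂ →
    totalWeight p₁ p₂ ℓ₁ ℓ₂ ≡ ι (weightDenominator p₁ p₂ ℓ₁ ℓ₂) * (legWeight ℓ₁ * legWeight ℓ₂)
  totalWeight-denominator p₁ p₂ ℓ₁ ℓ₂ = begin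
    P₁ * w₁ + P₂ * w₂                            ≡⟨ pad (P₁ * w₁) (P₂ * w₂) ⟩
    P₁ * w₁ * 1ℚ + P₂ * w₂ * 1ℚ                  ≡⟨ cong₂ (λ x y → P₁ * w₁ * y + P₂ * w₂ * x)
                                                          (legWeight-length ℓ₁) (legWeight-length ℓ₂) ⟨
    P₁ * w₁ * (w₂ * L₂) + P₂ * w₂ * (w₁ * L₁)    ≡⟨ regroup P₁ P₂ w₁ w₂ L₁ L₂ ⟩
    (L₂ * P₁ + L₁ * P₂) * (w₁ * w₂)              ≡⟨ cong (_* (w₁ * w₂)) denominator ⟨
    ι (weightDenominator p₁ p₂ ℓ₁ ℓ₂) * (w₁ * w₂) ∎
    where
    P₁ = ι p₁
    P₂ = ι p₂
    w₁ = legWeight ℓ₁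
    w₂ = legWeight ℓ₂
    L₁ = ι (suc (pred ℓ₁))
    L₂ = ι (suc (pred ℓ₂))
    pad : ∀ x y → x + y ≡ x * 1ℚ + y * 1ℚ
    pad = solve-∀ ℚ-ring
    regroup : ∀ P₁ P₂ w₁ w₂ L₁ L₂ →
      P₁ * w₁ * (w₂ * L₂) + P₂ * w₂ * (w₁ * L₁) ≡ (L₂ * P₁ + L₁ * P₂) * (w₁ * w₂)
    regroup = solve-∀ ℚ-ring
    denominator : ι (weightDenominator p₁ p₂ ℓ₁ ℓ₂) ≡ L₂ * P₁ + L₁ * P₂
    denominator = trans (ι-+ (suc (pred ℓ₂) ℕ.* p₁) _) (cong₂ _+_ (ι-* (suc (pred ℓ₂)) p₁) (ι-* (suc (pred ℓ₁)) p₂))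

  /-*-totalWeight : ∀ p₁ p₂ ℓ₁ ℓ₂ a .{{_ : NonZero (weightDenominator p₁ p₂ ℓ₁ ℓ₂)}} →
    (ℤ.+ a / weightDenominator p₁ p₂ ℓ₁ ℓ₂) * totalWeight p₁ p₂ ℓ₁ ℓ₂ ≡ ι a * (legWeight ℓ₁ * legWeight ℓ₂)
  /-*-totalWeight p₁ p₂ ℓ₁ ℓ₂ a = begin
    c * totalWeight p₁ p₂ ℓ₁ ℓ₂   ≡⟨ cong (c *_) (totalWeight-denominator p₁ p₂ ℓ₁ ℓ₂) ⟩
    c * (ι D * w₁w₂)              ≡⟨ ℚ.*-assoc c (ι D) w₁w₂ ⟨
    c * ι D * w₁w₂                ≡⟨ cong (_* w₁w₂) (/-*-ι a D) ⟩
    ι a * w₁w₂                    ∎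
    where
    D = weightDenominator p₁ p₂ ℓ₁ ℓ₂
    c = ℤ.+ a / D
    w₁w₂ = legWeight ℓ₁ * legWeight ℓ₂

  totalWeight-invertible : ∀ p₁ p₂ ℓ₁ ℓ₂ → 2 ≤ p₁ ℕ.+ p₂ → Σ ℚ λ s → s * totalWeight p₁ p₂ ℓ₁ ℓ₂ ≡ 1ℚ
  totalWeight-invertible p₁ p₂ ℓ₁ ℓ₂ 2≤p₁+p₂ = ℤ.+ (L₁ ℕ.* L₂) / D , (begin
    ℤ.+ (L₁ ℕ.* L₂) / D * totalWeight p₁ p₂ ℓ₁ ℓ₂  ≡⟨ /-*-totalWeight p₁ p₂ ℓ₁ ℓ₂ (L₁ ℕ.* L₂) ⟩
    ι (L₁ ℕ.* L₂) * (w₁ * w₂)                      ≡⟨ cong (_* (w₁ * w₂)) (ι-* L₁ L₂) ⟩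
    ι L₁ * ι L₂ * (w₁ * w₂)                        ≡⟨ regroup (ι L₁) (ι L₂) w₁ w₂ ⟩
    w₁ * ι L₁ * (w₂ * ι L₂)                        ≡⟨ cong₂ _*_ (legWeight-length ℓ₁) (legWeight-length ℓ₂) ⟩
    1ℚ * 1ℚ                                        ≡⟨⟩
    1ℚ                                             ∎)
    where
    L₁ = suc (pred ℓ₁)
    L₂ = suc (pred ℓ₂)
    w₁ = legWeight ℓ₁
    w₂ = legWeight ℓ₂
    D = weightDenominator p₁ p₂ ℓ₁ ℓ₂
    instance
      D-nonZero : NonZero D
      D-nonZero = ℕ.>-nonZero (ℕ.<-≤-trans (s≤s z≤n)
                    (ℕ.≤-trans 2≤p₁+p₂ (ℕ.+-mono-≤ (ℕ.m≤n*m p₁ L₂) (ℕ.m≤n*m p₂ L₁))))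
    regroup : ∀ a b x y → a * b * (x * y) ≡ x * a * (y * b)
    regroup = solve-∀ ℚ-ring

  blockPolynomial : (p₁ p₂ : ℕ) (w₁ w₂ s x : ℚ) → ℚ
  blockPolynomial p₁ p₂ w₁ w₂ s x =
    (x - w₁) ^ p₁ * (x - w₂) ^ p₂
    + (adjugateForm {p₁} (λ _ → x - w₁) (λ _ → w₁) (λ _ → s * w₁) * (x - w₂) ^ p₂
       + (x - w₁) ^ p₁ * adjugateForm {p₂} (λ _ → x - w₂) (λ _ → w₂) (λ _ → s * w₂))

  prodℚ-map-++ : (f : ℚ → ℚ) (xs ys : List ℚ) →
    prodℚ (map f (xs ++ ys)) ≡ prodℚ (map f xs) * prodℚ (map f ys)
  prodℚ-map-++ f []       ys = sym (ℚ.*-identityˡ _)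
  prodℚ-map-++ f (x ∷ xs) ys = trans (cong (f x *_) (prodℚ-map-++ f xs ys)) (sym (ℚ.*-assoc (f x) _ _))

  prodℚ-map-replicate : (f : ℚ → ℚ) (k : ℕ) (y : ℚ) → prodℚ (map f (replicate k y)) ≡ f y ^ k
  prodℚ-map-replicate f zero    y = refl
  prodℚ-map-replicate f (suc k) y = cong (f y *_) (prodℚ-map-replicate f k y)

  spectrum-product : ∀ p₁ p₂ ℓ₁ ℓ₂ x →
    prodℚ (map (λ σ → x - σ) (spiderSpectrum p₁ p₂ ℓ₁ ℓ₂))
    ≡ (x - 0ℚ) * ((x - legWeight ℓ₁) ^ (p₁ ∸ 1)
                  * (prodℚ (map (λ σ → x - σ) (midEig p₁ p₂ ℓ₁ ℓ₂)) * (x - legWeight ℓ₂) ^ (p₂ ∸ 1)))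
  spectrum-product p₁ p₂ ℓ₁ ℓ₂ x = cong ((x - 0ℚ) *_) (begin
    prodℚ (map f (replicate (p₁ ∸ 1) (legWeight ℓ₁) ++ middle ++ replicate (p₂ ∸ 1) (legWeight ℓ₂)))
      ≡⟨ prodℚ-map-++ f (replicate (p₁ ∸ 1) (legWeight ℓ₁)) _ ⟩
    prodℚ (map f (replicate (p₁ ∸ 1) (legWeight ℓ₁))) * prodℚ (map f (middle ++ replicate (p₂ ∸ 1) (legWeight ℓ₂)))
      ≡⟨ cong₂ _*_ (prodℚ-map-replicate f (p₁ ∸ 1) (legWeight ℓ₁))
                   (trans (prodℚ-map-++ f middle _)
                          (cong (prodℚ (map f middle) *_) (prodℚ-map-replicate f (p₂ ∸ 1) (legWeight ℓ₂)))) ⟩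
    (x - legWeight ℓ₁) ^ (p₁ ∸ 1) * (prodℚ (map f middle) * (x - legWeight ℓ₂) ^ (p₂ ∸ 1)) ∎)
    where
    f : ℚ → ℚ
    f σ = x - σ
    middle = midEig p₁ p₂ ℓ₁ ℓ₂

  defect-vanishes : ∀ {L R t} Y → L ≡ R + Y * (t - 1ℚ) → t ≡ 1ℚ → L ≡ R
  defect-vanishes {L} {R} Y L≡R+defect refl = trans L≡R+defect (no-defect R Y)
    where
    no-defect : ∀ R Y → R + Y * (1ℚ - 1ℚ) ≡ R
    no-defect = solve-∀ ℚ-ring

  two-leg-identity : ∀ x w₁ w₂ s μ P₁ P₂ X₁ X₂ →
    s * (P₁ * w₁ + P₂ * w₂) ≡ 1ℚ → μ * (P₁ * w₁ + P₂ * w₂) ≡ (P₁ + P₂) * (w₁ * w₂) →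
    (x - w₁) * X₁ * ((x - w₂) * X₂)
      + (P₁ * (w₁ * (s * w₁)) * X₁ * ((x - w₂) * X₂) + (x - w₁) * X₁ * (P₂ * (w₂ * (s * w₂)) * X₂))
    ≡ (x - 0ℚ) * (X₁ * ((x - μ) * 1ℚ * X₂))
  two-leg-identity x w₁ w₂ s μ P₁ P₂ X₁ X₂ s*S≡1 μ*S≡K =
    subst (λ m → _ ≡ (x - 0ℚ) * (X₁ * ((x - m) * 1ℚ * X₂))) s*K≡μ
      (defect-vanishes (X₁ * X₂ * (x * x - (x - w₁) * (x - w₂))) (expand x w₁ w₂ s P₁ P₂ X₁ X₂) s*S≡1)
    where
    expand : ∀ x w₁ w₂ s P₁ P₂ X₁ X₂ →
      (x - w₁) * X₁ * ((x - w₂) * X₂)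
        + (P₁ * (w₁ * (s * w₁)) * X₁ * ((x - w₂) * X₂) + (x - w₁) * X₁ * (P₂ * (w₂ * (s * w₂)) * X₂))
      ≡ (x - 0ℚ) * (X₁ * ((x - s * ((P₁ + P₂) * (w₁ * w₂))) * 1ℚ * X₂))
        + X₁ * X₂ * (x * x - (x - w₁) * (x - w₂)) * (s * (P₁ * w₁ + P₂ * w₂) - 1ℚ)
    expand = solve-∀ ℚ-ring
    s*K≡μ : s * ((P₁ + P₂) * (w₁ * w₂)) ≡ μ
    s*K≡μ = begin
      s * ((P₁ + P₂) * (w₁ * w₂))    ≡⟨ cong (s *_) μ*S≡K ⟨
      s * (μ * (P₁ * w₁ + P₂ * w₂))  ≡⟨ swap s μ (P₁ * w₁ + P₂ * w₂) ⟩
      μ * (s * (P₁ * w₁ + P₂ * w₂))  ≡⟨ cong (μ *_) s*S≡1 ⟩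
      μ * 1ℚ                         ≡⟨ ℚ.*-identityʳ μ ⟩
      μ                              ∎
      where
      swap : ∀ s μ S → s * (μ * S) ≡ μ * (s * S)
      swap = solve-∀ ℚ-ring

  first-leg-identity : ∀ x w₁ w₂ s P X → s * (P * w₁ + 0ℚ * w₂) ≡ 1ℚ →
    (x - w₁) * X * 1ℚ + (P * (w₁ * (s * w₁)) * X * 1ℚ + (x - w₁) * X * 0ℚ) ≡ (x - 0ℚ) * (X * (1ℚ * 1ℚ))
  first-leg-identity x w₁ w₂ s P X = defect-vanishes (X * w₁) (expand x w₁ w₂ s P X)
    where
    expand : ∀ x w₁ w₂ s P X →
      (x - w₁) * X * 1ℚ + (P * (w₁ * (s * w₁)) * X * 1ℚ + (x - w₁) * X * 0ℚ)
      ≡ (x - 0ℚ) * (X * (1ℚ * 1ℚ)) + X * w₁ * (s * (P * w₁ + 0ℚ * w₂) - 1ℚ)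
    expand = solve-∀ ℚ-ring

  second-leg-identity : ∀ x w₁ w₂ s P X → s * (0ℚ * w₁ + P * w₂) ≡ 1ℚ →
    1ℚ * ((x - w₂) * X) + (0ℚ * ((x - w₂) * X) + 1ℚ * (P * (w₂ * (s * w₂)) * X)) ≡ (x - 0ℚ) * (1ℚ * (1ℚ * X))
  second-leg-identity x w₁ w₂ s P X = defect-vanishes (X * w₂) (expand x w₁ w₂ s P X)
    where
    expand : ∀ x w₁ w₂ s P X →
      1ℚ * ((x - w₂) * X) + (0ℚ * ((x - w₂) * X) + 1ℚ * (P * (w₂ * (s * w₂)) * X))
      ≡ (x - 0ℚ) * (1ℚ * (1ℚ * X)) + X * w₂ * (s * (0ℚ * w₁ + P * w₂) - 1ℚ)
    expand = solve-∀ ℚ-ring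

  spectrum-polynomial : ∀ p₁ p₂ ℓ₁ ℓ₂ s x → 2 ≤ p₁ ℕ.+ p₂ → s * totalWeight p₁ p₂ ℓ₁ ℓ₂ ≡ 1ℚ →
    blockPolynomial p₁ p₂ (legWeight ℓ₁) (legWeight ℓ₂) s x
    ≡ prodℚ (map (λ σ → x - σ) (spiderSpectrum p₁ p₂ ℓ₁ ℓ₂))
  spectrum-polynomial zero    zero    ℓ₁ ℓ₂ s x () _
  spectrum-polynomial (suc a) zero    ℓ₁ ℓ₂ s x _ s*S≡1 = begin
    blockPolynomial (suc a) 0 w₁ w₂ s x
      ≡⟨ cong (λ R → A * A ^ a * 1ℚ + (R * 1ℚ + A * A ^ a * 0ℚ)) (adjugateForm-constant a A w₁ (s * w₁)) ⟩
    A * A ^ a * 1ℚ + (ι (suc a) * (w₁ * (s * w₁)) * A ^ a * 1ℚ + A * A ^ a * 0ℚ)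
      ≡⟨ first-leg-identity x w₁ w₂ s (ι (suc a)) (A ^ a) s*S≡1 ⟩
    (x - 0ℚ) * (A ^ a * (1ℚ * 1ℚ))
      ≡⟨ spectrum-product (suc a) 0 ℓ₁ ℓ₂ x ⟨
    prodℚ (map (λ σ → x - σ) (spiderSpectrum (suc a) 0 ℓ₁ ℓ₂)) ∎
    where
    w₁ = legWeight ℓ₁
    w₂ = legWeight ℓ₂
    A = x - w₁
  spectrum-polynomial zero    (suc b) ℓ₁ ℓ₂ s x _ s*S≡1 = begin
    blockPolynomial 0 (suc b) w₁ w₂ s x
      ≡⟨ cong (λ R → 1ℚ * (B * B ^ b) + (0ℚ * (B * B ^ b) + 1ℚ * R)) (adjugateForm-constant b B w₂ (s * w₂)) ⟩
    1ℚ * (B * B ^ b) + (0ℚ * (B * B ^ b) + 1ℚ * (ι (suc b) * (w₂ * (s * w₂)) * B ^ b))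
      ≡⟨ second-leg-identity x w₁ w₂ s (ι (suc b)) (B ^ b) s*S≡1 ⟩
    (x - 0ℚ) * (1ℚ * (1ℚ * B ^ b))
      ≡⟨ spectrum-product 0 (suc b) ℓ₁ ℓ₂ x ⟨
    prodℚ (map (λ σ → x - σ) (spiderSpectrum 0 (suc b) ℓ₁ ℓ₂)) ∎
    where
    w₁ = legWeight ℓ₁
    w₂ = legWeight ℓ₂
    B = x - w₂
  spectrum-polynomial (suc a) (suc b) ℓ₁ ℓ₂ s x _ s*S≡1 = begin
    blockPolynomial (suc a) (suc b) w₁ w₂ s x
      ≡⟨ cong₂ (λ R₁ R₂ → A * A ^ a * (B * B ^ b) + (R₁ * (B * B ^ b) + A * A ^ a * R₂))
               (adjugateForm-constant a A w₁ (s * w₁)) (adjugateForm-constant b B w₂ (s * w₂)) ⟩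
    A * A ^ a * (B * B ^ b)
      + (ι (suc a) * (w₁ * (s * w₁)) * A ^ a * (B * B ^ b) + A * A ^ a * (ι (suc b) * (w₂ * (s * w₂)) * B ^ b))
      ≡⟨ two-leg-identity x w₁ w₂ s μ (ι (suc a)) (ι (suc b)) (A ^ a) (B ^ b) s*S≡1 μ*S≡K ⟩
    (x - 0ℚ) * (A ^ a * ((x - μ) * 1ℚ * B ^ b))
      ≡⟨ spectrum-product (suc a) (suc b) ℓ₁ ℓ₂ x ⟨
    prodℚ (map (λ σ → x - σ) (spiderSpectrum (suc a) (suc b) ℓ₁ ℓ₂)) ∎
    where
    w₁ = legWeight ℓ₁
    w₂ = legWeight ℓ₂
    A = x - w₁
    B = x - w₂
    μ = ℤ.+ (suc a ℕ.+ suc b) / weightDenominator (suc a) (suc b) ℓ₁ ℓ₂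
    μ*S≡K : μ * (ι (suc a) * w₁ + ι (suc b) * w₂) ≡ (ι (suc a) + ι (suc b)) * (w₁ * w₂)
    μ*S≡K = trans (/-*-totalWeight (suc a) (suc b) ℓ₁ ℓ₂ (suc a ℕ.+ suc b))
                  (cong (_* (w₁ * w₂)) (ι-+ (suc a) (suc b)))

module Steklov where

  open import Data.Nat using (ℕ; zero; suc; pred)
  import Data.Nat as ℕ
  open import Data.Fin using (Fin; zero; suc; inject₁; fromℕ; toℕ; _↑ˡ_; _↑ʳ_)
  open import Data.Fin.Properties using (_≟_; toℕ-inject₁; toℕ-fromℕ; fromℕ≢inject₁; splitAt-↑ˡ; splitAt-↑ʳ)
  open import Data.Fin.Induction using (<-weakInduction)
  open import Data.List using ([]; [_]; map; tabulate)
  open import Data.List.Properties using (map-tabulate)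
  open import Data.Maybe using (just; nothing)
  open import Data.Bool using (if_then_else_)
  open import Data.Rational using (ℚ; 0ℚ; 1ℚ; _+_; _*_; _-_; -_; +-*-rawSemiring)
  import Data.Rational.Properties as ℚ
  open import Algebra.Bundles using (Ring)
  open import Algebra.Definitions.RawSemiring +-*-rawSemiring using (product; _^_)
  open import Algebra.Properties.Group ℚ.+-0-group using (x∙y⁻¹≈ε⇒x≈y)
  open import Algebra.Properties.Semiring.Sum (Ring.semiring ℚ.+-*-ring) using (sum; sum-cong-≗)
  open import Function using (_∘_)
  open import Relation.Nullary using (does; ¬_; contradiction)
  open import Relation.Binary.PropositionalEquality hiding ([_])
  open ≡-Reasoning
  open import Tactic.RingSolver using (solve-∀)
  open import Defs
  open Determinant
  open Spectrum

  private
    variable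
      n : ℕ

  sumℚ-map-tabulate : {A : Set} (f : A → ℚ) (g : Fin n → A) → sumℚ (map f (tabulate g)) ≡ sum (f ∘ g)
  sumℚ-map-tabulate {zero}  f g = refl
  sumℚ-map-tabulate {suc n} f g = cong (f (g zero) +_) (sumℚ-map-tabulate f (g ∘ suc))

  unit : Fin n → Fin n → ℚ
  unit = diagonal (λ _ → 1ℚ)

  apply-unit : (M : Matrix n) (c r : Fin n) → apply M (unit c) r ≡ M r c
  apply-unit {n} M c r = begin
    apply M (unit c) r                  ≡⟨ sumℚ-map-tabulate (λ j → M r j * unit c j) (λ j → j) ⟩
    sum (λ j → M r j * unit c j)        ≡⟨ sum-cong-≗ (λ j → ℚ.*-comm (M r j) (unit c j)) ⟩
    sum (λ j → unit c j * M r j)        ≡⟨ sum-diagonal (λ _ → 1ℚ) (M r) c ⟩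
    1ℚ * M r c                          ≡⟨ ℚ.*-identityˡ (M r c) ⟩
    M r c                               ∎

  record HarmonicExtension (G : Graph) {b : ℕ} (bd : Fin b → V G) (f : Fin b → ℚ) : Set where
    field
      function : V G → ℚ
      boundary : ∀ k → function (bd k) ≡ f k
      harmonic : ∀ v → (∀ k → ¬ bd k ≡ v) → laplacian G function v ≡ 0ℚ

  steklov-unique : (G : Graph) {b : ℕ} (bd : Fin b → V G) → (∀ f → HarmonicExtension G bd f) →
    {M N : Matrix b} → IsSteklovMatrix G bd M → IsSteklovMatrix G bd N → ∀ r c → M r c ≡ N r c
  steklov-unique G bd extend {M} {N} M-steklov N-steklov r c = begin
    M r c                           ≡⟨ apply-unit M c r ⟨
    apply M (unit c) r              ≡⟨ M-steklov (unit c) g boundary harmonic r ⟩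
    laplacian G g (bd r)            ≡⟨ N-steklov (unit c) g boundary harmonic r ⟨
    apply N (unit c) r              ≡⟨ apply-unit N c r ⟩
    N r c                           ∎
    where
    open HarmonicExtension (extend (unit c)) renaming (function to g)

  data Position {m : ℕ} : Fin (suc m) → Set where
    inner : (k : Fin m) → Position (inject₁ k)
    last  : Position (fromℕ m)

  position : ∀ {m} (j : Fin (suc m)) → Position j
  position {zero}  zero    = last
  position {suc m} zero    = inner zero
  position {suc m} (suc j) with position j
  ... | inner k = inner (suc k)
  ... | last    = last

  module SpiderSteklov (p₁ p₂ ℓ₁ ℓ₂ : ℕ) where

    open Spider p₁ p₂ ℓ₁ ℓ₂

    nextPos-inject₁ : ∀ {m} (k : Fin m) → nextPos (inject₁ k) ≡ just (suc k)
    nextPos-inject₁ {suc m} zero    = refl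
    nextPos-inject₁ {suc m} (suc k) rewrite nextPos-inject₁ k = refl

    nextPos-fromℕ : ∀ m → nextPos (fromℕ m) ≡ nothing
    nextPos-fromℕ zero    = refl
    nextPos-fromℕ (suc m) rewrite nextPos-fromℕ m = refl

    nextV-inner : ∀ i (k : Fin (pred (len i))) → nextV i (inject₁ k) ≡ [ leg i (suc k) ]
    nextV-inner i k rewrite nextPos-inject₁ k = refl

    nextV-last : ∀ i → nextV i (fromℕ (pred (len i))) ≡ []
    nextV-last i rewrite nextPos-fromℕ (pred (len i)) = refl

    Leg : Set
    Leg = Fin (p₁ ℕ.+ p₂)

    increment : (SpV → ℚ) → (i : Leg) → Fin (suc (pred (len i))) → ℚ
    increment g i j = g (leg i j) - g (prevV i j)

    laplacian-inner : ∀ g i (k : Fin (pred (len i))) →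
      laplacian graph g (leg i (inject₁ k)) ≡ increment g i (inject₁ k) - increment g i (suc k)
    laplacian-inner g i k rewrite nextV-inner i k =
      second-difference (g (leg i (inject₁ k))) (g (prevV i (inject₁ k))) (g (leg i (suc k)))
      where
      second-difference : ∀ x p y → (x - p) + ((x - y) + 0ℚ) ≡ (x - p) - (y - x)
      second-difference = solve-∀ ℚ-ring

    laplacian-leaf : ∀ g i → laplacian graph g (leaf i) ≡ increment g i (fromℕ (pred (len i)))
    laplacian-leaf g i rewrite nextV-last i = ℚ.+-identityʳ _

    laplacian-center : ∀ g → laplacian graph g center ≡ - sum (λ i → increment g i zero)
    laplacian-center g = begin
      sumℚ (map (λ y → g center - g y) (map (λ i → leg i zero) (tabulate (λ i → i))))
        ≡⟨ cong (sumℚ ∘ map (λ y → g center - g y)) (map-tabulate (λ i → i) (λ i → leg i zero)) ⟩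
      sumℚ (map (λ y → g center - g y) (tabulate (λ i → leg i zero)))
        ≡⟨ sumℚ-map-tabulate (λ y → g center - g y) (λ i → leg i zero) ⟩
      sum (λ i → g center - g (leg i zero))
        ≡⟨ sum-cong-≗ (λ i → flip-difference (g center) (g (leg i zero))) ⟩
      sum (λ i → - increment g i zero)
        ≡⟨ sum-neg (λ i → increment g i zero) ⟩
      - sum (λ i → increment g i zero) ∎
      where
      flip-difference : ∀ c x → c - x ≡ - (x - c)
      flip-difference = solve-∀ ℚ-ring

    Harmonic : (SpV → ℚ) → Set
    Harmonic g = ∀ v → (∀ k → ¬ leaf k ≡ v) → laplacian graph g v ≡ 0ℚ

    leaf≡leg⇒last : ∀ {k i j} → leaf k ≡ leg i j → fromℕ (pred (len i)) ≡ j
    leaf≡leg⇒last refl = refl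

    increments-constant : ∀ g → Harmonic g → ∀ i j → increment g i j ≡ increment g i zero
    increments-constant g harmonic i = <-weakInduction (λ j → increment g i j ≡ increment g i zero) refl step
      where
      step : ∀ k → increment g i (inject₁ k) ≡ increment g i zero → increment g i (suc k) ≡ increment g i zero
      step k constant = trans (sym (x∙y⁻¹≈ε⇒x≈y _ _ balanced)) constant
        where
        balanced : increment g i (inject₁ k) - increment g i (suc k) ≡ 0ℚ
        balanced = trans (sym (laplacian-inner g i k))
                         (harmonic (leg i (inject₁ k)) (λ k′ eq → fromℕ≢inject₁ (leaf≡leg⇒last eq)))

    profile : ∀ g i d → (∀ j → increment g i j ≡ d) → ∀ j → g (leg i j) ≡ g center + ι (suc (toℕ j)) * d
    profile g i d constant = <-weakInduction (λ j → g (leg i j) ≡ g center + ι (suc (toℕ j)) * d) first step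
      where
      first : g (leg i zero) ≡ g center + 1ℚ * d
      first = begin
        g (leg i zero)                          ≡⟨ add-back (g (leg i zero)) (g center) ⟩
        g center + 1ℚ * increment g i zero      ≡⟨ cong (λ x → g center + 1ℚ * x) (constant zero) ⟩
        g center + 1ℚ * d                       ∎
        where
        add-back : ∀ x c → x ≡ c + 1ℚ * (x - c)
        add-back = solve-∀ ℚ-ring
      step : ∀ k → g (leg i (inject₁ k)) ≡ g center + ι (suc (toℕ (inject₁ k))) * d →
                   g (leg i (suc k)) ≡ g center + ι (suc (suc (toℕ k))) * d
      step k previous = begin
        g (leg i (suc k))                                   ≡⟨ add-back (g (leg i (suc k))) (g (leg i (inject₁ k))) ⟩
        g (leg i (inject₁ k)) + increment g i (suc k)       ≡⟨ cong₂ _+_ previous (constant (suc k)) ⟩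
        g center + ι (suc (toℕ (inject₁ k))) * d + d
          ≡⟨ cong (λ t → g center + ι (suc t) * d + d) (toℕ-inject₁ k) ⟩
        g center + ι (suc (toℕ k)) * d + d                  ≡⟨ one-more (g center) (ι (suc (toℕ k))) d ⟩
        g center + (1ℚ + ι (suc (toℕ k))) * d              ≡⟨ cong (λ t → g center + t * d) (ι-+ 1 (suc (toℕ k))) ⟨
        g center + ι (suc (suc (toℕ k))) * d                ∎
        where
        add-back : ∀ x p → x ≡ p + (x - p)
        add-back = solve-∀ ℚ-ring
        one-more : ∀ c t d → c + t * d + d ≡ c + (1ℚ + t) * d
        one-more = solve-∀ ℚ-ring

    linearExtension : ℚ → (Leg → ℚ) → SpV → ℚ
    linearExtension c d center    = c
    linearExtension c d (leg i j) = c + ι (suc (toℕ j)) * d i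

    increment-linearExtension : ∀ c d i j → increment (linearExtension c d) i j ≡ d i
    increment-linearExtension c d i zero    = unit-step c (d i)
      where
      unit-step : ∀ c d → c + 1ℚ * d - c ≡ d
      unit-step = solve-∀ ℚ-ring
    increment-linearExtension c d i (suc k) = begin
      c + ι (suc (suc (toℕ k))) * d i - (c + ι (suc (toℕ (inject₁ k))) * d i)
        ≡⟨ cong₂ (λ s t → c + s * d i - (c + ι (suc t) * d i)) (ι-+ 1 (suc (toℕ k))) (toℕ-inject₁ k) ⟩
      c + (1ℚ + ι (suc (toℕ k))) * d i - (c + ι (suc (toℕ k)) * d i)
        ≡⟨ one-step c (ι (suc (toℕ k))) (d i) ⟩
      d i ∎
      where
      one-step : ∀ c t d → c + (1ℚ + t) * d - (c + t * d) ≡ d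
      one-step = solve-∀ ℚ-ring

    harmonic-if-balanced : ∀ g (d : Leg → ℚ) → (∀ i j → increment g i j ≡ d i) → sum d ≡ 0ℚ → Harmonic g
    harmonic-if-balanced g d constant Σd≡0 center _ = begin
      laplacian graph g center             ≡⟨ laplacian-center g ⟩
      - sum (λ i → increment g i zero)     ≡⟨ cong -_ (trans (sum-cong-≗ (λ i → constant i zero)) Σd≡0) ⟩
      - 0ℚ                                 ≡⟨⟩
      0ℚ                                   ∎
    harmonic-if-balanced g d constant Σd≡0 (leg i j) not-leaf with position j
    ... | inner k = begin
      laplacian graph g (leg i (inject₁ k))                   ≡⟨ laplacian-inner g i k ⟩
      increment g i (inject₁ k) - increment g i (suc k)       ≡⟨ cong₂ _-_ (constant i (inject₁ k)) (constant i (suc k)) ⟩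
      d i - d i                                               ≡⟨ ℚ.+-inverseʳ (d i) ⟩
      0ℚ                                                      ∎
    ... | last    = contradiction refl (not-leaf i)

    weight : Leg → ℚ
    weight i = legWeight (len i)

    weight-↑ˡ : ∀ i → weight (i ↑ˡ p₂) ≡ legWeight ℓ₁
    weight-↑ˡ i rewrite splitAt-↑ˡ p₁ i p₂ = refl

    weight-↑ʳ : ∀ i → weight (p₁ ↑ʳ i) ≡ legWeight ℓ₂
    weight-↑ʳ i rewrite splitAt-↑ʳ p₁ p₂ i = refl

    sum-weight : sum weight ≡ totalWeight p₁ p₂ ℓ₁ ℓ₂
    sum-weight = trans (sum-split {p₁} {p₂} weight) (cong₂ _+_ (sum-constant _ weight-↑ˡ) (sum-constant _ weight-↑ʳ))

    weightedSum : (Leg → ℚ) → ℚ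
    weightedSum f = sum (λ i → weight i * f i)

    sum-slopes : ∀ f c → sum (λ i → weight i * (f i - c)) ≡ weightedSum f - c * sum weight
    sum-slopes f c = begin
      sum (λ i → weight i * (f i - c))                 ≡⟨ sum-cong-≗ (λ i → spread (weight i) (f i) c) ⟩
      sum (λ i → 1ℚ * (weight i * f i) + - c * weight i) ≡⟨ sum-linear 1ℚ (- c) (λ i → weight i * f i) weight ⟩
      1ℚ * weightedSum f + - c * sum weight            ≡⟨ collect (weightedSum f) c (sum weight) ⟩
      weightedSum f - c * sum weight                   ∎
      where
      spread : ∀ w f c → w * (f - c) ≡ 1ℚ * (w * f) + - c * w
      spread = solve-∀ ℚ-ring
      collect : ∀ W c Σ → 1ℚ * W + - c * Σ ≡ W - c * Σ
      collect = solve-∀ ℚ-ring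

    leaf-value : ∀ g i {d} → (∀ j → increment g i j ≡ d) → g (leaf i) ≡ g center + ι (suc (pred (len i))) * d
    leaf-value g i {d} constant =
      trans (profile g i d constant (fromℕ m)) (cong (λ t → g center + ι (suc t) * d) (toℕ-fromℕ m))
      where
      m = pred (len i)

    slope-of-rise : ∀ i c d → weight i * (c + ι (suc (pred (len i))) * d - c) ≡ d
    slope-of-rise i c d = begin
      weight i * (c + L * d - c)   ≡⟨ rearrange (weight i) L d c ⟩
      weight i * L * d             ≡⟨ cong (_* d) (legWeight-length (len i)) ⟩
      1ℚ * d                       ≡⟨ ℚ.*-identityˡ d ⟩
      d                            ∎
      where
      L = ι (suc (pred (len i)))
      rearrange : ∀ w L d c → w * (c + L * d - c) ≡ w * L * d
      rearrange = solve-∀ ℚ-ring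

    rise-of-slope : ∀ i c y → c + ι (suc (pred (len i))) * (weight i * (y - c)) ≡ y
    rise-of-slope i c y = begin
      c + L * (weight i * (y - c))   ≡⟨ rearrange c L (weight i) y ⟩
      c + weight i * L * (y - c)     ≡⟨ cong (λ x → c + x * (y - c)) (legWeight-length (len i)) ⟩
      c + 1ℚ * (y - c)               ≡⟨ cancel c y ⟩
      y                              ∎
      where
      L = ι (suc (pred (len i)))
      rearrange : ∀ c L w y → c + L * (w * (y - c)) ≡ c + w * L * (y - c)
      rearrange = solve-∀ ℚ-ring
      cancel : ∀ c y → c + 1ℚ * (y - c) ≡ y
      cancel = solve-∀ ℚ-ring

    module _ {f : Leg → ℚ} (g : SpV → ℚ) (harmonic : Harmonic g) (boundary : ∀ k → g (leaf k) ≡ f k) where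

      harmonic-slope : ∀ i → increment g i zero ≡ weight i * (f i - g center)
      harmonic-slope i = begin
        increment g i zero                                                   ≡⟨ slope-of-rise i (g center) _ ⟨
        weight i * (g center + ι (suc (pred (len i))) * increment g i zero - g center)
          ≡⟨ cong (λ y → weight i * (y - g center))
                  (trans (sym (leaf-value g i (increments-constant g harmonic i))) (boundary i)) ⟩
        weight i * (f i - g center)                                          ∎

      harmonic-mean : weightedSum f ≡ g center * sum weight
      harmonic-mean = x∙y⁻¹≈ε⇒x≈y _ _ (begin
        weightedSum f - g center * sum weight   ≡⟨ sum-slopes f (g center) ⟨
        sum (λ i → weight i * (f i - g center)) ≡⟨ sum-cong-≗ (λ i → sym (harmonic-slope i)) ⟩
        sum (λ i → increment g i zero)
          ≡⟨ ℚ.neg-injective (trans (sym (laplacian-center g)) (harmonic center λ k ())) ⟩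
        0ℚ                                      ∎)

    two-block-form : ∀ s x →
      product (λ i → x - weight i) + adjugateForm (λ i → x - weight i) weight (λ i → s * weight i)
      ≡ blockPolynomial p₁ p₂ (legWeight ℓ₁) (legWeight ℓ₂) s x
    two-block-form s x = cong₂ _+_ product-blocks adjugate-blocks
      where
      w₁ = legWeight ℓ₁
      w₂ = legWeight ℓ₂
      first-block : product (λ i → x - weight (i ↑ˡ p₂)) ≡ (x - w₁) ^ p₁
      first-block = product-constant (λ i → x - weight (i ↑ˡ p₂)) (λ i → cong (λ w → x - w) (weight-↑ˡ i))
      second-block : product (λ i → x - weight (p₁ ↑ʳ i)) ≡ (x - w₂) ^ p₂
      second-block = product-constant (λ i → x - weight (p₁ ↑ʳ i)) (λ i → cong (λ w → x - w) (weight-↑ʳ i))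
      product-blocks : product (λ i → x - weight i) ≡ (x - w₁) ^ p₁ * (x - w₂) ^ p₂
      product-blocks = trans (product-split {p₁} {p₂} (λ i → x - weight i)) (cong₂ _*_ first-block second-block)
      adjugate-blocks : adjugateForm (λ i → x - weight i) weight (λ i → s * weight i) ≡
        adjugateForm {p₁} (λ _ → x - w₁) (λ _ → w₁) (λ _ → s * w₁) * (x - w₂) ^ p₂
          + (x - w₁) ^ p₁ * adjugateForm {p₂} (λ _ → x - w₂) (λ _ → w₂) (λ _ → s * w₂)
      adjugate-blocks = trans (adjugateForm-split {p₁} {p₂} (λ i → x - weight i) weight (λ i → s * weight i))
        (cong₂ _+_ (cong₂ _*_ (block {p₁} (λ i → weight (i ↑ˡ p₂)) weight-↑ˡ) second-block)
                   (cong₂ _*_ first-block (block {p₂} (λ i → weight (p₁ ↑ʳ i)) weight-↑ʳ)))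
        where
        block : ∀ {k} (w′ : Fin k → ℚ) {c} → (∀ i → w′ i ≡ c) →
          adjugateForm (λ i → x - w′ i) w′ (λ i → s * w′ i) ≡ adjugateForm {k} (λ _ → x - c) (λ _ → c) (λ _ → s * c)
        block w′ w′≡c = adjugateForm-cong (λ i → cong (λ w → x - w) (w′≡c i)) w′≡c (λ i → cong (s *_) (w′≡c i))

    module SteklovMatrix (s : ℚ) (s*Σw≡1 : s * sum weight ≡ 1ℚ) where

      steklovMatrix : Matrix (p₁ ℕ.+ p₂)
      steklovMatrix r c = diagonal weight r c - weight r * (s * weight c)

      apply-steklovMatrix : ∀ f k → apply steklovMatrix f k ≡ weight k * (f k - s * weightedSum f)
      apply-steklovMatrix f k = begin
        apply steklovMatrix f k
          ≡⟨ sumℚ-map-tabulate (λ j → steklovMatrix k j * f j) (λ j → j) ⟩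
        sum (λ j → steklovMatrix k j * f j)
          ≡⟨ sum-cong-≗ (λ j → expand (diagonal weight k j) (weight k) s (weight j) (f j)) ⟩
        sum (λ j → 1ℚ * (diagonal weight k j * f j) + - (weight k * s) * (weight j * f j))
          ≡⟨ sum-linear 1ℚ (- (weight k * s)) (λ j → diagonal weight k j * f j) (λ j → weight j * f j) ⟩
        1ℚ * sum (λ j → diagonal weight k j * f j) + - (weight k * s) * weightedSum f
          ≡⟨ cong (λ x → 1ℚ * x + - (weight k * s) * weightedSum f) (sum-diagonal weight f k) ⟩
        1ℚ * (weight k * f k) + - (weight k * s) * weightedSum f
          ≡⟨ collect (weight k) (f k) s (weightedSum f) ⟩
        weight k * (f k - s * weightedSum f) ∎
        where
        expand : ∀ δ w s v f → (δ - w * (s * v)) * f ≡ 1ℚ * (δ * f) + - (w * s) * (v * f)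
        expand = solve-∀ ℚ-ring
        collect : ∀ w f s Σ → 1ℚ * (w * f) + - (w * s) * Σ ≡ w * (f - s * Σ)
        collect = solve-∀ ℚ-ring

      steklovMatrix-isSteklov : IsSteklovMatrix graph leaf steklovMatrix
      steklovMatrix-isSteklov f g boundary harmonic k = begin
        apply steklovMatrix f k                   ≡⟨ apply-steklovMatrix f k ⟩
        weight k * (f k - s * weightedSum f)      ≡⟨ cong (λ x → weight k * (f k - x)) centre-value ⟨
        weight k * (f k - g center)               ≡⟨ harmonic-slope g harmonic boundary k ⟨
        increment g k zero                        ≡⟨ increments-constant g harmonic k (fromℕ (pred (len k))) ⟨
        increment g k (fromℕ (pred (len k)))      ≡⟨ laplacian-leaf g k ⟨
        laplacian graph g (leaf k)                ∎
        where
        centre-value : g center ≡ s * weightedSum f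
        centre-value = begin
          g center                      ≡⟨ ℚ.*-identityʳ (g center) ⟨
          g center * 1ℚ                 ≡⟨ cong (g center *_) s*Σw≡1 ⟨
          g center * (s * sum weight)   ≡⟨ swap (g center) s (sum weight) ⟩
          s * (g center * sum weight)   ≡⟨ cong (s *_) (harmonic-mean g harmonic boundary) ⟨
          s * weightedSum f             ∎
          where
          swap : ∀ c s Σ → c * (s * Σ) ≡ s * (c * Σ)
          swap = solve-∀ ℚ-ring

      harmonicExtension : ∀ f → HarmonicExtension graph leaf f
      harmonicExtension f = record
        { function = linearExtension c d
        ; boundary = λ k → trans (leaf-value (linearExtension c d) k (increment-linearExtension c d k))
                                 (rise-of-slope k c (f k))
        ; harmonic = harmonic-if-balanced (linearExtension c d) d (increment-linearExtension c d) balanced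
        }
        where
        c : ℚ
        c = s * weightedSum f
        d : Leg → ℚ
        d i = weight i * (f i - c)
        balanced : sum d ≡ 0ℚ
        balanced = begin
          sum d                                            ≡⟨ sum-slopes f c ⟩
          weightedSum f - s * weightedSum f * sum weight   ≡⟨ factor (weightedSum f) s (sum weight) ⟩
          weightedSum f - weightedSum f * (s * sum weight) ≡⟨ cong (λ x → weightedSum f - weightedSum f * x) s*Σw≡1 ⟩
          weightedSum f - weightedSum f * 1ℚ               ≡⟨ vanish (weightedSum f) ⟩
          0ℚ                                               ∎
          where
          factor : ∀ W s Σ → W - s * W * Σ ≡ W - W * (s * Σ)
          factor = solve-∀ ℚ-ring
          vanish : ∀ W → W - W * 1ℚ ≡ 0ℚ
          vanish = solve-∀ ℚ-ring

      steklovMatrix-unique : ∀ {M} → IsSteklovMatrix graph leaf M → ∀ r c → M r c ≡ steklovMatrix r c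
      steklovMatrix-unique M-steklov = steklov-unique graph leaf harmonicExtension M-steklov steklovMatrix-isSteklov

      charPoly-steklov : ∀ {M} → IsSteklovMatrix graph leaf M → ∀ x →
        charPoly M x ≡ blockPolynomial p₁ p₂ (legWeight ℓ₁) (legWeight ℓ₂) s x
      charPoly-steklov {M} M-steklov x =
        trans (det-diagonal+rankOne (λ i → x - weight i) weight (λ i → s * weight i) entry) (two-block-form s x)
        where
        entry : ∀ r c →
          (if does (r ≟ c) then x else 0ℚ) - M r c ≡ diagonal (λ i → x - weight i) r c + weight r * (s * weight c)
        entry r c = trans (cong (λ m → (if does (r ≟ c) then x else 0ℚ) - m) (steklovMatrix-unique {M} M-steklov r c))
                          (diagonal-shift x weight (weight r * (s * weight c)) r c)

open import Data.Nat using (ℕ; _≤_; _+_)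
open import Data.Rational using (ℚ; _-_; _*_)
open import Data.List using (map)
open import Data.Product using (∃; _×_; _,_; proj₁; proj₂)
open import Relation.Binary.PropositionalEquality using (_≡_; trans; cong; module ≡-Reasoning)
open import Defs
open Spectrum using (legWeight; blockPolynomial; totalWeight-invertible; spectrum-polynomial)
open Steklov using (module SpiderSteklov)
open ≡-Reasoning

lemma2p3 : (p₁ p₂ ℓ₁ ℓ₂ : ℕ) → 1 ≤ ℓ₂ → ℓ₂ ≤ ℓ₁ → 2 ≤ p₁ + p₂ →
    (∃ λ M → IsSteklovMatrix (Spider.graph p₁ p₂ ℓ₁ ℓ₂) (Spider.leaf p₁ p₂ ℓ₁ ℓ₂) M)
    × (∀ M → IsSteklovMatrix (Spider.graph p₁ p₂ ℓ₁ ℓ₂) (Spider.leaf p₁ p₂ ℓ₁ ℓ₂) M →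
        ∀ (x : ℚ) → charPoly M x ≡ prodℚ (map (λ σ → x - σ) (spiderSpectrum p₁ p₂ ℓ₁ ℓ₂)))
lemma2p3 p₁ p₂ ℓ₁ ℓ₂ _ _ 2≤p₁+p₂ = (steklovMatrix , steklovMatrix-isSteklov) , spectrum
  where
  open Spider p₁ p₂ ℓ₁ ℓ₂ using (graph; leaf)
  open SpiderSteklov p₁ p₂ ℓ₁ ℓ₂
  s = proj₁ (totalWeight-invertible p₁ p₂ ℓ₁ ℓ₂ 2≤p₁+p₂)
  s*S≡1 = proj₂ (totalWeight-invertible p₁ p₂ ℓ₁ ℓ₂ 2≤p₁+p₂)
  open SteklovMatrix s (trans (cong (s *_) sum-weight) s*S≡1)
  spectrum : ∀ M → IsSteklovMatrix graph leaf M → ∀ x →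
    charPoly M x ≡ prodℚ (map (λ σ → x - σ) (spiderSpectrum p₁ p₂ ℓ₁ ℓ₂))
  spectrum M M-steklov x = begin
    charPoly M x
      ≡⟨ charPoly-steklov M-steklov x ⟩
    blockPolynomial p₁ p₂ (legWeight ℓ₁) (legWeight ℓ₂) s x
      ≡⟨ spectrum-polynomial p₁ p₂ ℓ₁ ℓ₂ s x 2≤p₁+p₂ s*S≡1 ⟩
    prodℚ (map (λ σ → x - σ) (spiderSpectrum p₁ p₂ ℓ₁ ℓ₂)) ∎
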